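{- Let $n\ge2$ and $1\le k\le n-1$. Identify each vertex $v\in\mathcal F_{n,k}$ of $\mathcal D^\ast_{n,k}$ with the variable $x_{\Psi(v)}$. Then the Stanley–Reisner ideal of $\mathcal D^\ast_{n,k}$ in the polynomial ring $\mathbb K[x_{\Psi(v)}: v\in\mathcal F_{n,k}]$ is generated by the monomials $$m_{A,B}=\prod_{(i,j)\in N(A,B)}x_{ij},\qquad A,B\subseteq[n],\ |A|=|B|=k+1.$$
   Context: Label the vertices of a convex regular $2n$-gon by $1,\dots,2n$ in cyclic order. A segment is a $2$-subset $\{a,b\}\subseteq[2n]$. Two segments cross if their four endpoints are distinct and interleave in the cyclic order. A $(k+1)$-crossing is a set of $k+1$ pairwise crossing segments. The cyclic length of $\{a,b\}$ is $\min(|a-b|,2n-|a-b|)$, and $\Omega_{2n,k}$ is the set of segments of cyclic length $>k$. The $180^\circ$-rotation sends $\{a,b\}$ to $\{a+n,b+n\}$ (indices mod $2n$). $\mathcal F_n$ is the set of rotation orbits of all segments, and $\mathcal F_{n,k}\subseteq\mathcal F_n$ is the set of orbits of segments in $\Omega_{2n,k}$. $\mathcal D^\ast_{n,k}$ is the simplicial complex on $\mathcal F_{n,k}$ whose faces are the sets of orbits whose union contains no $(k+1)$-crossing. Throughout, "$m \bmod n$" denotes the representative in $\{1,\dots,n\}$ (so $n\bmod n=n$). The bijection $\Psi:\mathcal F_n\to[n]\times[n]$ sends an orbit to $((a+1)\bmod n,\ b\bmod n)$ if $b-a\le n$, and to $((b+1)\bmod n,\ a\bmod n)$ if $b-a>n$,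 where $\{a<b\}$ is any segment in the orbit (the value does not depend on this choice). For $s\ge1$ and $A=\{a_1<\dots<a_s\}$, $B=\{b_1<\dots<b_s\}\subseteq[n]$, let $\ell$ be the least integer $0\le\ell\le s$ such that $a_{i+\ell}>b_i$ for all $1\le i\le s-\ell$. Then set $N(A,B)=\{(a_{(i+\ell)\bmod s},b_i): i=1,\dots,s\}$, with $\bmod s$ taking values in $\{1,\dots,s\}$. -}

module Defs where

open import Data.Nat using (ℕ; zero; suc; _+_; _∸_; _≤_; _<_; _<ᵇ_; _≤ᵇ_)
open import Data.Nat.DivMod using (_%_)
open import Data.Bool using (Bool; if_then_else_)
open import Data.Bool using (true; _∧_)
open import Data.Sum using (_⊎_)
open import Data.Fin using (Fin)
open import Data.Product using (Σ; ∃; _×_; _,_; proj₁; proj₂)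
open import Relation.Binary.PropositionalEquality using (_≡_; _≢_)

-- "m mod t" with representative in {1,…,t}  (for t ≥ 1).
-- For t = suc u:  ((m + u) mod (u+1)) + 1, which is ≡ m (mod t) and lies in [1,t].
md : ℕ → ℕ → ℕ
md m zero    = m
md m (suc u) = suc ((m + u) % suc u)

-- Segments of the 2n-gon: a segment {a,b} is represented by the ordered
-- pair (a , b) with 1 ≤ a < b ≤ 2n.
Segment : Set
Segment = ℕ × ℕ

IsSegment : ℕ → Segment → Set
IsSegment n (a , b) = 1 ≤ a × a < b × b ≤ n + n

Cross : Segment → Segment → Set
Cross (a , b) (c , d) = (a < c × c < b × b < d) ⊎ (c < a × a < d × d < b)

cycLen : ℕ → Segment → ℕ
cycLen n (a , b) = let d = b ∸ a in if d ≤ᵇ (n + n) ∸ d then d else (n + n) ∸ d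

InΩ : ℕ → ℕ → Segment → Set
InΩ n k s = IsSegment n s × k < cycLen n s

-- The bijection Ψ, computed on any representative segment {a<b} of an orbit.
Ψ : ℕ → Segment → ℕ × ℕ
Ψ n (a , b) = if (b ∸ a) ≤ᵇ n then (md (a + 1) n , md b n)
                               else (md (b + 1) n , md a n)

-- Variables of the polynomial ring: x_{ij} with (i,j) = Ψ(v), v ∈ F_{n,k}.
-- (v is the orbit of a segment s ∈ Ω_{2n,k}; Ψ(v) = Ψ n s.)
InRing : ℕ → ℕ → ℕ → ℕ → Set
InRing n k i j = Σ Segment λ s → InΩ n k s × Ψ n s ≡ (i , j)

-- Monomials: exponent functions e i j (exponent of x_{ij}).
Monomial : Set
Monomial = ℕ → ℕ → ℕ

IsRingMonomial : ℕ → ℕ → Monomial → Set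
IsRingMonomial n k e = ∀ i j → e i j ≢ 0 → InRing n k i j

-- Support of a monomial, as a set of vertices of D*_{n,k}, contains a
-- (k+1)-crossing in the union of its orbits: there are k+1 pairwise
-- crossing segments, each in Ω_{2n,k}, whose orbits are in the support
-- (the orbit of s is the vertex with variable x_{Ψ(s)}).
SupportHasCrossing : ℕ → ℕ → Monomial → Set
SupportHasCrossing n k e =
  Σ (Fin (suc k) → Segment) λ σ →
    (∀ r → InΩ n k (σ r) × 1 ≤ e (proj₁ (Ψ n (σ r))) (proj₂ (Ψ n (σ r))))
    × (∀ r t → r ≢ t → Cross (σ r) (σ t))

-- Monomial x^e lies in the Stanley–Reisner ideal I_{D*_{n,k}}
-- (the ideal spanned by monomials whose support is a non-face,
-- i.e. whose support's union of orbits contains a (k+1)-crossing).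
InSR : ℕ → ℕ → Monomial → Set
InSR n k e = SupportHasCrossing n k e

-- A = {a₁<…<a_s} ⊆ [n] given by an increasing sequence a : ℕ → ℕ
-- (only the values at indices 1..s matter).
SortedSubset : ℕ → ℕ → (ℕ → ℕ) → Set
SortedSubset n s a =
  (∀ i → 1 ≤ i → i ≤ s → 1 ≤ a i × a i ≤ n)
  × (∀ i → 1 ≤ i → i < s → a i < a (suc i))

good : (ℕ → ℕ) → (ℕ → ℕ) → ℕ → ℕ → Bool
good a b s ℓ = go (s ∸ ℓ)
  where
  go : ℕ → Bool
  go zero    = true
  go (suc m) = go m ∧ (b (suc m) <ᵇ a (suc m + ℓ))

-- search for the least ℓ ≥ ℓ₀ with good, trying at most `fuel` values,
-- returning ℓ₀ + fuel by default
search : (ℕ → ℕ) → (ℕ → ℕ) → ℕ → ℕ → ℕ → ℕ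
search a b s ℓ zero     = ℓ
search a b s ℓ (suc f) = if good a b s ℓ then ℓ else search a b s (suc ℓ) f

-- the least 0 ≤ ℓ ≤ s such that a_{i+ℓ} > b_i for 1 ≤ i ≤ s-ℓ
-- (ℓ = s always qualifies vacuously)
leastℓ : (ℕ → ℕ) → (ℕ → ℕ) → ℕ → ℕ
leastℓ a b s = search a b s 0 s

InN : (ℕ → ℕ) → (ℕ → ℕ) → ℕ → ℕ → ℕ → Set
InN a b s p q =
  Σ ℕ λ i → 1 ≤ i × i ≤ s × p ≡ a (md (i + leastℓ a b s) s) × q ≡ b i

-- Monomial x^e lies in the ideal generated by the m_{A,B}, |A|=|B|=k+1:
-- some m_{A,B} = ∏_{(i,j)∈N(A,B)} x_{ij} (squarefree) divides x^e.
InGen : ℕ → ℕ → Monomial → Set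
InGen n k e =
  Σ (ℕ → ℕ) λ a → Σ (ℕ → ℕ) λ b →
    SortedSubset n (suc k) a × SortedSubset n (suc k) b
    × (∀ p q → InN a b (suc k) p q → 1 ≤ e p q)

-- A (k+1)-crossing, sorted as x₁ < ⋯ < xₛ < y₁ < ⋯ < yₛ and with each segment replaced by the
-- member {u, v} of its rotation orbit with v − u ≤ n, becomes after a cyclic shift a family
-- α₁ < ⋯ < αₛ ≤ β₁ < ⋯ < βₛ with βⱼ < αⱼ + n, from which Ψ reads off (αⱼ, βⱼ) modulo n.
-- Sorting these residues gives A and B, and the cyclic shift relating them is the least ℓ in
-- the definition of N(A,B). Conversely, A, B and ℓ yield s arcs of the circle unrolled to length
-- 4n, all through one point, of lengths between s and n and concordantly ordered; their chords
-- are pairwise crossing segments of Ω_{2n,k} whose Ψ-values are exactly N(A,B).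
module Submission where

open import Defs
open import Data.Bool using (Bool; true; false; T; _∧_; if_then_else_)
open import Data.Bool.Properties using (T-≡)
open import Data.Empty using (⊥-elim)
open import Data.Fin using (Fin; toℕ) renaming (_≟_ to _≟ᶠ_)
open import Data.Fin.Properties using (toℕ<n; toℕ-injective; any?)
open import Data.List using (List; []; _∷_; length; tabulate)
open import Data.List.Membership.Propositional using (_∈_)
open import Data.List.Membership.Propositional.Properties using (∈-tabulate⁻)
open import Data.List.Properties using (length-tabulate)
open import Data.List.Relation.Binary.Permutation.Propositional using (↭-sym; ↭⇒↭ₛ)
open import Data.List.Relation.Binary.Permutation.Propositional.Properties using (∈-resp-↭; ↭-length)
import Data.List.Relation.Unary.All as All
import Data.List.Relation.Unary.AllPairs as AllPairs
open import Data.List.Relation.Unary.Any using (here; there)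
open import Data.List.Relation.Unary.Linked as Linked using (Linked)
open import Data.List.Relation.Unary.Unique.Propositional using (Unique)
open import Data.List.Relation.Unary.Unique.Propositional.Properties using (tabulate⁺)
open import Data.Nat
open import Data.Nat.DivMod using (_%_; [m+n]%n≡m%n; m<n⇒m%n≡m; m%n<n; %-distribˡ-+; m%n%n≡m%n)
open import Data.Nat.Properties
open import Data.Nat.Tactic.RingSolver using (solve; solve-∀)
open import Data.Product using (∃; ∃-syntax; _×_; _,_; proj₁; proj₂)
open import Data.Sum using (_⊎_; inj₁; inj₂)
open import Function.Base using (_∘_)
open import Function.Bundles using (_⇔_; mk⇔; Equivalence)
open import Relation.Binary using (tri<; tri≈; tri>)
open import Relation.Binary.PropositionalEquality
open import Relation.Nullary using (¬_; Dec; yes; no; ¬?)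
open import Relation.Nullary.Decidable using (decidable-stable)
open import Data.List.Relation.Binary.Permutation.Setoid.Properties (setoid ℕ) using (Unique-resp-↭)
open import Data.List.Sort ≤-decTotalOrder using (sort; sort-↭; sort-↗)


≤ᵇ-true : ∀ {m n} → m ≤ n → (m ≤ᵇ n) ≡ true
≤ᵇ-true m≤n = Equivalence.to T-≡ (≤⇒≤ᵇ m≤n)

≤ᵇ-false : ∀ {m n} → n < m → (m ≤ᵇ n) ≡ false
≤ᵇ-false {m} {n} n<m with m ≤ᵇ n in eq
... | false = refl
... | true  = ⊥-elim (<⇒≱ n<m (≤ᵇ⇒≤ m n (subst T (sym eq) _)))

<ᵇ-true : ∀ {m n} → m < n → (m <ᵇ n) ≡ true
<ᵇ-true m<n = Equivalence.to T-≡ (<⇒<ᵇ m<n)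

<ᵇ-false : ∀ {m n} → n ≤ m → (m <ᵇ n) ≡ false
<ᵇ-false {m} {n} n≤m with m <ᵇ n in eq
... | false = refl
... | true  = ⊥-elim (<⇒≱ (<ᵇ⇒< m n (subst T (sym eq) _)) n≤m)

-- Linear arithmetic: sum the hypotheses into P ≤ Q, then let the ring solver check the identity.
linear-≤ : ∀ {P Q m n} c → P ≤ Q → n + P ≡ m + Q + c → m ≤ n
linear-≤ {P} {Q} {m} {n} c P≤Q eq =
  +-cancelʳ-≤ Q m n (≤-trans (m≤m+n (m + Q) c) (subst (_≤ n + Q) eq (+-monoʳ-≤ n P≤Q)))

1≤m≤n∸o⇒m+o≤n : ∀ {m n o} → 1 ≤ m → m ≤ n ∸ o → m + o ≤ n
1≤m≤n∸o⇒m+o≤n {m} {n} {o} 1≤m m≤n∸o with o ≤? n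
... | yes o≤n = m≤o∸n⇒m+n≤o m o≤n m≤n∸o
... | no  o≰n = ⊥-elim (<⇒≱ (≤-trans 1≤m m≤n∸o) (≤-reflexive (m≤n⇒m∸n≡0 (<⇒≤ (≰⇒> o≰n)))))

≰-excess : ∀ {c y} → ¬ (y ≤ c) → ∃[ q ] (1 ≤ q × y ≡ q + c)
≰-excess {c} {y} y≰c with m≤n⇒∃[o]m+o≡n (≰⇒> y≰c)
... | o , eq = suc o , s≤s z≤n , trans (sym eq) (cong suc (+-comm c o))

md-id : ∀ n x → 1 ≤ x → x ≤ n → md x n ≡ x
md-id (suc u) (suc x) _ x≤n = cong suc (begin
    (suc x + u) % suc u ≡⟨ cong (_% suc u) (sym (+-suc x u)) ⟩
    (x + suc u) % suc u ≡⟨ [m+n]%n≡m%n x (suc u) ⟩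
    x % suc u           ≡⟨ m<n⇒m%n≡m x≤n ⟩
    x                   ∎)
  where open ≡-Reasoning

md-bounds : ∀ x n → 1 ≤ n → 1 ≤ md x n × md x n ≤ n
md-bounds x (suc u) _ = s≤s z≤n , s≤s (≤-pred (m%n<n (x + u) (suc u)))

md-periodic : ∀ n x → md (x + n) n ≡ md x n
md-periodic zero    x = +-identityʳ x
md-periodic (suc u) x = cong suc (begin
    (x + suc u + u) % suc u ≡⟨ cong (_% suc u) (swap x u) ⟩
    (x + u + suc u) % suc u ≡⟨ [m+n]%n≡m%n (x + u) (suc u) ⟩
    (x + u) % suc u         ∎)
  where
  open ≡-Reasoning
  swap : ∀ x u → x + suc u + u ≡ x + u + suc u
  swap = solve-∀

md-periodic₂ : ∀ n x → md (x + (n + n)) n ≡ md x n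
md-periodic₂ n x = begin
  md (x + (n + n)) n ≡⟨ cong (λ z → md z n) (sym (+-assoc x n n)) ⟩
  md (x + n + n) n   ≡⟨ md-periodic n (x + n) ⟩
  md (x + n) n       ≡⟨ md-periodic n x ⟩
  md x n             ∎
  where open ≡-Reasoning

md-∸ : ∀ n x → n ≤ x → md (x ∸ n) n ≡ md x n
md-∸ n x n≤x = trans (sym (md-periodic n (x ∸ n))) (cong (λ z → md z n) (m∸n+n≡m n≤x))

md-md-+ : ∀ x y s → 1 ≤ s → md (md x s + y) s ≡ md (x + y) s
md-md-+ x y (suc u) _ = cong suc (begin
    (suc ((x + u) % suc u) + y + u) % suc u ≡⟨ cong (_% suc u) (shift ((x + u) % suc u)) ⟩
    ((x + u) % suc u + y + suc u) % suc u   ≡⟨ [m+n]%n≡m%n ((x + u) % suc u + y) (suc u) ⟩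
    ((x + u) % suc u + y) % suc u           ≡⟨ %-distribˡ-+ ((x + u) % suc u) y (suc u) ⟩
    ((x + u) % suc u % suc u + y % suc u) % suc u ≡⟨ cong (λ z → (z + y % suc u) % suc u) (m%n%n≡m%n (x + u) (suc u)) ⟩
    ((x + u) % suc u + y % suc u) % suc u   ≡⟨ sym (%-distribˡ-+ (x + u) y (suc u)) ⟩
    (x + u + y) % suc u                     ≡⟨ cong (_% suc u) (swap x u y) ⟩
    (x + y + u) % suc u                     ∎)
  where
  open ≡-Reasoning
  shift : ∀ r → suc r + y + u ≡ r + y + suc u
  shift r = solve (r ∷ y ∷ u ∷ [])
  swap : ∀ x u y → x + u + y ≡ x + y + u
  swap = solve-∀

md-wrap : ∀ s x → s < x → x ≤ s + s → md x s ≡ x ∸ s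
md-wrap s x s<x x≤2s with ≰-excess {s} {x} (<⇒≱ s<x)
... | y , 1≤y , refl rewrite m+n∸n≡m y s =
  trans (md-periodic s y) (md-id s y 1≤y (+-cancelʳ-≤ s y s x≤2s))

md-lift₁ : ∀ x n → n < x → x ≤ n + n → md x n + n ≡ x
md-lift₁ x n n<x x≤2n = trans (cong (_+ n) (md-wrap n x n<x x≤2n)) (m∸n+n≡m (<⇒≤ n<x))

md-lift₂ : ∀ x n → n + n < x → x ≤ n + n + n → md x n + (n + n) ≡ x
md-lift₂ x n 2n<x x≤3n with ≰-excess {n + n} {x} (<⇒≱ 2n<x)
... | y , 1≤y , refl = cong (_+ (n + n)) (trans (md-periodic₂ n y)
      (md-id n y 1≤y (+-cancelʳ-≤ (n + n) y n (subst (y + (n + n) ≤_) (+-comm (n + n) n) x≤3n))))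

Increasing : ℕ → (ℕ → ℕ) → Set
Increasing s a = ∀ i → 1 ≤ i → i < s → a i < a (suc i)

increasing-spread : ∀ {s} a → Increasing s a → ∀ p d → 1 ≤ p → p + d ≤ s → a p + d ≤ a (p + d)
increasing-spread a inc p zero    _   _ rewrite +-identityʳ p | +-identityʳ (a p) = ≤-refl
increasing-spread {s} a inc p (suc d) 1≤p p+d<s = begin
    a p + suc d       ≡⟨ +-suc (a p) d ⟩
    suc (a p + d)     ≤⟨ s≤s (increasing-spread a inc p d 1≤p (≤-trans (+-monoʳ-≤ p (n≤1+n d)) p+d<s)) ⟩
    suc (a (p + d))   ≤⟨ inc (p + d) (≤-trans 1≤p (m≤m+n p d)) (subst (_≤ s) (+-suc p d) p+d<s) ⟩
    a (suc (p + d))   ≡⟨ cong a (sym (+-suc p d)) ⟩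
    a (p + suc d)     ∎
  where open ≤-Reasoning

increasing-mono-≤ : ∀ {s} a → Increasing s a → ∀ {p q} → 1 ≤ p → p ≤ q → q ≤ s → a p ≤ a q
increasing-mono-≤ {s} a inc {p} 1≤p p≤q q≤s with m≤n⇒∃[o]m+o≡n p≤q
... | d , refl = ≤-trans (m≤m+n (a p) d) (increasing-spread a inc p d 1≤p q≤s)

increasing-mono-< : ∀ {s} a → Increasing s a → ∀ {p q} → 1 ≤ p → p < q → q ≤ s → a p < a q
increasing-mono-< a inc 1≤p p<q q≤s =
  <-≤-trans (inc _ 1≤p (<-≤-trans p<q q≤s)) (increasing-mono-≤ a inc (s≤s z≤n) p<q q≤s)

module _ {n s : ℕ} {a : ℕ → ℕ} (A : SortedSubset n s a) where

  sorted-pos : ∀ {i} → 1 ≤ i → i ≤ s → 1 ≤ a i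
  sorted-pos 1≤i i≤s = proj₁ (proj₁ A _ 1≤i i≤s)

  sorted-≤n : ∀ {i} → 1 ≤ i → i ≤ s → a i ≤ n
  sorted-≤n 1≤i i≤s = proj₂ (proj₁ A _ 1≤i i≤s)

  sorted-md : ∀ {i} → 1 ≤ i → i ≤ s → md (a i) n ≡ a i
  sorted-md 1≤i i≤s = md-id n (a _) (sorted-pos 1≤i i≤s) (sorted-≤n 1≤i i≤s)

  sorted-mono-≤ : ∀ {i j} → 1 ≤ i → i ≤ j → j ≤ s → a i ≤ a j
  sorted-mono-≤ = increasing-mono-≤ a (proj₂ A)

  sorted-mono-< : ∀ {i j} → 1 ≤ i → i < j → j ≤ s → a i < a j
  sorted-mono-< = increasing-mono-< a (proj₂ A)

  sorted-spread : ∀ {i} d → 1 ≤ i → i + d ≤ s → a i + d ≤ a (i + d)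
  sorted-spread d = increasing-spread a (proj₂ A) _ d

  index≤sorted : ∀ {i} → 1 ≤ i → i ≤ s → i ≤ a i
  index≤sorted {suc d} _ i≤s =
    ≤-trans (+-monoˡ-≤ d (sorted-pos ≤-refl (≤-trans (s≤s z≤n) i≤s))) (sorted-spread d ≤-refl i≤s)

  sorted-room : ∀ {i} d → 1 ≤ i → i + d ≤ s → a i + d ≤ n
  sorted-room d 1≤i i+d≤s = ≤-trans (sorted-spread d 1≤i i+d≤s) (sorted-≤n (≤-trans 1≤i (m≤m+n _ d)) i+d≤s)

Good : (ℕ → ℕ) → (ℕ → ℕ) → ℕ → ℕ → Set
Good a b s ℓ = ∀ i → 1 ≤ i → i + ℓ ≤ s → b i < a (i + ℓ)

Violated : (ℕ → ℕ) → (ℕ → ℕ) → ℕ → ℕ → Set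
Violated a b s ℓ = ∃[ i ] (1 ≤ i × i + ℓ ≤ s × a (i + ℓ) ≤ b i)

goodUpTo : (ℕ → ℕ) → (ℕ → ℕ) → ℕ → ℕ → Bool
goodUpTo a b ℓ zero    = true
goodUpTo a b ℓ (suc m) = goodUpTo a b ℓ m ∧ (b (suc m) <ᵇ a (suc m + ℓ))

goodUpTo-unique : ∀ a b ℓ (g : ℕ → Bool) → g 0 ≡ true →
  (∀ m → g (suc m) ≡ (g m ∧ (b (suc m) <ᵇ a (suc m + ℓ)))) → ∀ w → g w ≡ goodUpTo a b ℓ w
goodUpTo-unique a b ℓ g g0 gsuc zero    = g0
goodUpTo-unique a b ℓ g g0 gsuc (suc w) = trans (gsuc w) (cong (_∧ _) (goodUpTo-unique a b ℓ g g0 gsuc w))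

-- `good` runs a loop local to its definition; it can only be named as the solution of the meta `goodLoop`.
mutual
  goodLoop : (ℕ → ℕ) → (ℕ → ℕ) → ℕ → ℕ → ℕ → Bool
  goodLoop = _

  good≡goodUpTo : ∀ a b s ℓ → good a b s ℓ ≡ goodUpTo a b ℓ (s ∸ ℓ)
  good≡goodUpTo a b s ℓ with s ∸ ℓ
  ... | w = goodUpTo-unique a b ℓ (goodLoop a b s ℓ) refl (λ _ → refl) w

goodUpTo-sound : ∀ a b ℓ w → goodUpTo a b ℓ w ≡ true → ∀ i → 1 ≤ i → i ≤ w → b i < a (i + ℓ)
goodUpTo-sound a b ℓ zero    h (suc i) 1≤i ()
goodUpTo-sound a b ℓ (suc w) h i 1≤i i≤1+w with m≤n⇒m<n∨m≡n i≤1+w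
... | inj₁ (s≤s i≤w) = goodUpTo-sound a b ℓ w (∧-true₁ h) i 1≤i i≤w
  where
  ∧-true₁ : ∀ {x y} → (x ∧ y) ≡ true → x ≡ true
  ∧-true₁ {true} _ = refl
... | inj₂ refl with goodUpTo a b ℓ w
... | true = <ᵇ⇒< _ _ (subst T (sym h) _)

goodUpTo-complete : ∀ a b ℓ w → (∀ i → 1 ≤ i → i ≤ w → b i < a (i + ℓ)) → goodUpTo a b ℓ w ≡ true
goodUpTo-complete a b ℓ zero    _ = refl
goodUpTo-complete a b ℓ (suc w) h
  rewrite goodUpTo-complete a b ℓ w (λ i 1≤i i≤w → h i 1≤i (m≤n⇒m≤1+n i≤w)) = <ᵇ-true (h (suc w) (s≤s z≤n) ≤-refl)

goodUpTo-false : ∀ a b ℓ w → goodUpTo a b ℓ w ≡ false → ∃[ i ] (1 ≤ i × i ≤ w × a (i + ℓ) ≤ b i)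
goodUpTo-false a b ℓ (suc w) h with goodUpTo a b ℓ w in eq
... | false with goodUpTo-false a b ℓ w eq
...   | i , 1≤i , i≤w , violation = i , 1≤i , m≤n⇒m≤1+n i≤w , violation
goodUpTo-false a b ℓ (suc w) h | true =
  suc w , s≤s z≤n , ≤-refl , ≮⇒≥ (λ lt → subst T h (<⇒<ᵇ lt))

good-sound : ∀ a b s ℓ → good a b s ℓ ≡ true → Good a b s ℓ
good-sound a b s ℓ h i 1≤i i+ℓ≤s =
  goodUpTo-sound a b ℓ (s ∸ ℓ) (trans (sym (good≡goodUpTo a b s ℓ)) h) i 1≤i (m+n≤o⇒m≤o∸n i i+ℓ≤s)

good-complete : ∀ a b s ℓ → Good a b s ℓ → good a b s ℓ ≡ true
good-complete a b s ℓ g = trans (good≡goodUpTo a b s ℓ)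
  (goodUpTo-complete a b ℓ (s ∸ ℓ) (λ i 1≤i i≤s∸ℓ → g i 1≤i (1≤m≤n∸o⇒m+o≤n 1≤i i≤s∸ℓ)))

good-false : ∀ a b s ℓ → good a b s ℓ ≡ false → Violated a b s ℓ
good-false a b s ℓ h with goodUpTo-false a b ℓ (s ∸ ℓ) (trans (sym (good≡goodUpTo a b s ℓ)) h)
... | i , 1≤i , i≤s∸ℓ , violation = i , 1≤i , 1≤m≤n∸o⇒m+o≤n 1≤i i≤s∸ℓ , violation

good-at-s : ∀ a b s → Good a b s s
good-at-s a b s i 1≤i i+s≤s = ⊥-elim (1+n≰n (≤-trans (+-monoˡ-≤ s 1≤i) i+s≤s))

record LeastGoodFrom (a b : ℕ → ℕ) (s ℓ₀ r : ℕ) : Set where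
  field
    from≤   : ℓ₀ ≤ r
    ≤s      : r ≤ s
    isGood  : Good a b s r
    isLeast : ∀ j → ℓ₀ ≤ j → j < r → good a b s j ≡ false

search-spec : ∀ a b s f ℓ₀ → ℓ₀ + f ≡ s → LeastGoodFrom a b s ℓ₀ (search a b s ℓ₀ f)
search-spec a b s zero ℓ₀ refl rewrite +-identityʳ ℓ₀ =
  record { from≤ = ≤-refl ; ≤s = ≤-refl ; isGood = good-at-s a b ℓ₀ ; isLeast = λ j ℓ₀≤j j<ℓ₀ → ⊥-elim (<⇒≱ j<ℓ₀ ℓ₀≤j) }
search-spec a b s (suc f) ℓ₀ eq with good a b s ℓ₀ in isGood
... | true = record
  { from≤ = ≤-refl ; ≤s = subst (ℓ₀ ≤_) eq (m≤m+n ℓ₀ (suc f)) ; isGood = good-sound a b s ℓ₀ isGood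
  ; isLeast = λ j ℓ₀≤j j<ℓ₀ → ⊥-elim (<⇒≱ j<ℓ₀ ℓ₀≤j) }
... | false = record
  { from≤ = ≤-trans (n≤1+n ℓ₀) from≤ ; ≤s = ≤s ; isGood = isGood′ ; isLeast = isLeast′ }
  where
  open LeastGoodFrom (search-spec a b s f (suc ℓ₀) (trans (sym (+-suc ℓ₀ f)) eq))
    renaming (isGood to isGood′)
  isLeast′ : ∀ j → ℓ₀ ≤ j → j < search a b s (suc ℓ₀) f → good a b s j ≡ false
  isLeast′ j ℓ₀≤j j<r with m≤n⇒m<n∨m≡n ℓ₀≤j
  ... | inj₁ ℓ₀<j = isLeast j ℓ₀<j j<r
  ... | inj₂ refl = isGood

leastℓ-spec : ∀ a b s → LeastGoodFrom a b s 0 (leastℓ a b s)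
leastℓ-spec a b s = search-spec a b s s 0 refl

leastℓ-suc : ∀ a b s L → leastℓ a b s ≡ suc L → Violated a b s L
leastℓ-suc a b s L eq = good-false a b s L (isLeast L z≤n (subst (L <_) (sym eq) ≤-refl))
  where open LeastGoodFrom (leastℓ-spec a b s)

good-mono : ∀ a b s → Increasing s a → ∀ {ℓ ℓ′} → ℓ ≤ ℓ′ → Good a b s ℓ → Good a b s ℓ′
good-mono a b s inc {ℓ} {ℓ′} ℓ≤ℓ′ g i 1≤i i+ℓ′≤s =
  <-≤-trans (g i 1≤i (≤-trans (+-monoʳ-≤ i ℓ≤ℓ′) i+ℓ′≤s))
            (increasing-mono-≤ a inc (≤-trans 1≤i (m≤m+n i ℓ)) (+-monoʳ-≤ i ℓ≤ℓ′) i+ℓ′≤s)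

leastℓ-unique : ∀ a b s ℓ → Increasing s a → ℓ ≤ s → Good a b s ℓ →
  (∀ L → ℓ ≡ suc L → Violated a b s L) → leastℓ a b s ≡ ℓ
leastℓ-unique a b s ℓ inc ℓ≤s g tight with <-cmp (leastℓ a b s) ℓ
... | tri≈ _ eq _ = eq
... | tri> _ _ ℓ<least = ⊥-elim (true≢false (trans (sym (good-complete a b s ℓ g)) (isLeast ℓ z≤n ℓ<least)))
  where
  open LeastGoodFrom (leastℓ-spec a b s)
  true≢false : true ≢ false
  true≢false ()
leastℓ-unique a b s (suc L) inc ℓ≤s g tight | tri< least<ℓ _ _ with tight L refl
... | i , 1≤i , i+L≤s , violation =
  ⊥-elim (<⇒≱ (good-mono a b s inc (≤-pred least<ℓ) isGood i 1≤i i+L≤s) violation)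
  where open LeastGoodFrom (leastℓ-spec a b s)

Cross-sym : ∀ x y → Cross x y → Cross y x
Cross-sym (a , b) (c , d) (inj₁ interleave) = inj₂ interleave
Cross-sym (a , b) (c , d) (inj₂ interleave) = inj₁ interleave

m≤n⇒m≤n+n∸m : ∀ {m n} → m ≤ n → m ≤ (n + n) ∸ m
m≤n⇒m≤n+n∸m {m} {n} m≤n = ≤-trans m≤n (subst (_≤ (n + n) ∸ m) (m+n∸n≡m n n) (∸-monoʳ-≤ (n + n) m≤n))

cycLen-short : ∀ n a b → b ∸ a ≤ n → cycLen n (a , b) ≡ b ∸ a
cycLen-short n a b d≤n rewrite ≤ᵇ-true (m≤n⇒m≤n+n∸m d≤n) = refl

cycLen-long : ∀ n a b → n ≤ b ∸ a → cycLen n (a , b) ≡ (n + n) ∸ (b ∸ a)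
cycLen-long n a b n≤d with (b ∸ a) ≤ᵇ (n + n) ∸ (b ∸ a) in eq
... | false = refl
... | true  = trans d≡n (sym (trans (cong ((n + n) ∸_) d≡n) (m+n∸n≡m n n)))
  where
  d≤n : b ∸ a ≤ n
  d≤n = ≤-trans (≤ᵇ⇒≤ _ _ (subst T (sym eq) _))
          (subst ((n + n) ∸ (b ∸ a) ≤_) (m+n∸n≡m n n) (∸-monoʳ-≤ (n + n) n≤d))
  d≡n : b ∸ a ≡ n
  d≡n = ≤-antisym d≤n n≤d

Ψ-short : ∀ n a b → b ∸ a ≤ n → Ψ n (a , b) ≡ (md (a + 1) n , md b n)
Ψ-short n a b d≤n rewrite ≤ᵇ-true d≤n = refl

Ψ-long : ∀ n a b → n < b ∸ a → Ψ n (a , b) ≡ (md (b + 1) n , md a n)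
Ψ-long n a b n<d rewrite ≤ᵇ-false n<d = refl

-- The chord of the 2n-gon between the vertices X < Y, each read modulo 2n (X ≤ 2n < Y ≤ 4n is allowed).
chord : ℕ → ℕ → ℕ → Segment
chord n X Y = if Y ≤ᵇ n + n then (X , Y)
              else if X ≤ᵇ n + n then (Y ∸ (n + n) , X) else (X ∸ (n + n) , Y ∸ (n + n))

chord-inside : ∀ n X Y → Y ≤ n + n → chord n X Y ≡ (X , Y)
chord-inside n X Y Y≤2n rewrite ≤ᵇ-true Y≤2n = refl

chord-wrap : ∀ n X q → 1 ≤ q → X ≤ n + n → chord n X (q + (n + n)) ≡ (q , X)
chord-wrap n X q 1≤q X≤2n
  rewrite ≤ᵇ-false {q + (n + n)} {n + n} (+-monoˡ-≤ (n + n) 1≤q) | ≤ᵇ-true X≤2n | m+n∸n≡m q (n + n) = refl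

chord-outside : ∀ n p q → 1 ≤ p → 1 ≤ q → chord n (p + (n + n)) (q + (n + n)) ≡ (p , q)
chord-outside n p q 1≤p 1≤q
  rewrite ≤ᵇ-false {q + (n + n)} {n + n} (+-monoˡ-≤ (n + n) 1≤q)
        | ≤ᵇ-false {p + (n + n)} {n + n} (+-monoˡ-≤ (n + n) 1≤p)
        | m+n∸n≡m q (n + n) | m+n∸n≡m p (n + n) = refl

chord-cross : ∀ n P P′ Q Q′ → P < P′ → P′ < Q → Q < Q′ → P ≤ n + n → Q′ < P + (n + n) →
  Cross (chord n P Q) (chord n P′ Q′)
chord-cross n P P′ Q Q′ P<P′ P′<Q Q<Q′ P≤2n Q′<P+2n with Q′ ≤? n + n
... | yes Q′≤2n rewrite chord-inside n P Q (≤-trans (<⇒≤ Q<Q′) Q′≤2n) | chord-inside n P′ Q′ Q′≤2n =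
  inj₁ (P<P′ , P′<Q , Q<Q′)
... | no Q′≰2n with ≰-excess Q′≰2n
... | q′ , 1≤q′ , refl with Q ≤? n + n
... | yes Q≤2n rewrite chord-inside n P Q Q≤2n | chord-wrap n P′ q′ 1≤q′ (≤-trans (<⇒≤ P′<Q) Q≤2n) =
  inj₂ (+-cancelʳ-< (n + n) q′ P Q′<P+2n , P<P′ , P′<Q)
... | no Q≰2n with ≰-excess Q≰2n
... | q , 1≤q , refl with P′ ≤? n + n
... | yes P′≤2n rewrite chord-wrap n P q 1≤q P≤2n | chord-wrap n P′ q′ 1≤q′ P′≤2n =
  inj₁ (+-cancelʳ-< (n + n) q q′ Q<Q′ , +-cancelʳ-< (n + n) q′ P Q′<P+2n , P<P′)
... | no P′≰2n with ≰-excess P′≰2n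
... | p′ , 1≤p′ , refl rewrite chord-wrap n P q 1≤q P≤2n | chord-outside n p′ q′ 1≤p′ 1≤q′ =
  inj₂ (+-cancelʳ-< (n + n) p′ q P′<Q , +-cancelʳ-< (n + n) q q′ Q<Q′ , +-cancelʳ-< (n + n) q′ P Q′<P+2n)

record ChordOf (n X Y : ℕ) (σ : Segment) : Set where
  field
    isSegment : IsSegment n σ
    cycLen≡   : cycLen n σ ≡ Y ∸ X
    Ψ≡        : Ψ n σ ≡ (md (X + 1) n , md Y n)

chord-short : ∀ n X Y → 1 ≤ n → 1 ≤ X → X < Y → Y ≤ X + n → X < n + n → ChordOf n X Y (chord n X Y)
chord-short n X Y 1≤n 1≤X X<Y Y≤X+n X<2n with Y ≤? n + n
... | yes Y≤2n rewrite chord-inside n X Y Y≤2n = record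
  { isSegment = 1≤X , X<Y , Y≤2n
  ; cycLen≡   = cycLen-short n X Y (m≤n+o⇒m∸n≤o Y X Y≤X+n)
  ; Ψ≡        = Ψ-short n X Y (m≤n+o⇒m∸n≤o Y X Y≤X+n) }
... | no Y≰2n with ≰-excess Y≰2n
... | q , 1≤q , refl with m≤n⇒∃[o]m+o≡n (<⇒≤ q<X)
  where
  q<X : q < X
  q<X = linear-≤ 0 (+-mono-≤ Y≤X+n 1≤n) (solve (q ∷ n ∷ X ∷ []))
... | e , refl rewrite chord-wrap n (q + e) q 1≤q (<⇒≤ X<2n) = record
  { isSegment = 1≤q , m<m+n q (≤-trans 1≤n n≤e) , <⇒≤ X<2n
  ; cycLen≡   = begin
      cycLen n (q , q + e)   ≡⟨ cycLen-long n q (q + e) n≤d ⟩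
      (n + n) ∸ (q + e ∸ q)  ≡⟨ cong ((n + n) ∸_) (m+n∸m≡n q e) ⟩
      (n + n) ∸ e            ≡⟨ sym ([m+n]∸[m+o]≡n∸o q (n + n) e) ⟩
      q + (n + n) ∸ (q + e)  ∎
  ; Ψ≡        = Ψ-wrapped (m≤n⇒m<n∨m≡n n≤e) }
  where
  open ≡-Reasoning
  n≤e : n ≤ e
  n≤e = linear-≤ 0 Y≤X+n (solve (q ∷ e ∷ n ∷ []))
  n≤d : n ≤ q + e ∸ q
  n≤d = subst (n ≤_) (sym (m+n∸m≡n q e)) n≤e
  Ψ-wrapped : n < e ⊎ n ≡ e → Ψ n (q , q + e) ≡ (md (q + e + 1) n , md (q + (n + n)) n)
  Ψ-wrapped (inj₁ n<e) = trans (Ψ-long n q (q + e) (subst (n <_) (sym (m+n∸m≡n q e)) n<e))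
                           (cong (md (q + e + 1) n ,_) (sym (md-periodic₂ n q)))
  Ψ-wrapped (inj₂ refl) = trans (Ψ-short n q (q + n) (≤-reflexive (m+n∸m≡n q n))) (cong₂ _,_
    (trans (sym (md-periodic n (q + 1))) (cong (λ z → md z n) (shift q n)))
    (trans (sym (md-periodic n (q + n))) (cong (λ z → md z n) (+-assoc q n n))))
    where
    shift : ∀ q n → q + 1 + n ≡ q + n + 1
    shift = solve-∀

-- The arc from vertex x − 1 to vertex y of the circle unrolled to length 4n; it passes through the point c.
record Arc (n s c x y : ℕ) : Set where
  field
    2≤x   : 2 ≤ x
    x≤c   : x ≤ c
    c≤y   : c ≤ y
    y<x+n : y < x + n
    long  : x + s ≤ suc y

arcChord : ℕ → ℕ → ℕ → Segment
arcChord n x y = chord n (pred x) y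

arcChord-Ω : ∀ {n s c x y} → 1 ≤ n → c ≤ n + n → Arc n s c x y →
  IsSegment n (arcChord n x y) × s ≤ cycLen n (arcChord n x y) × Ψ n (arcChord n x y) ≡ (md x n , md y n)
arcChord-Ω {n} {s} {c} {suc X} {y} 1≤n c≤2n arc =
  isSegment , subst (s ≤_) (sym cycLen≡) s≤y∸X , trans Ψ≡ (cong (λ z → md z n , md y n) (+-comm X 1))
  where
  open Arc arc
  open ChordOf (chord-short n X y 1≤n (≤-pred 2≤x) (≤-trans x≤c c≤y) (≤-pred y<x+n) (≤-trans x≤c c≤2n))
  s≤y∸X : s ≤ y ∸ X
  s≤y∸X = subst (_≤ y ∸ X) (m+n∸m≡n X s) (∸-monoˡ-≤ X (≤-pred long))

arcChord-cross : ∀ {n s c x y x′ y′} → c ≤ n + n → Arc n s c x y → Arc n s c x′ y′ → x < x′ → y < y′ →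
  Cross (arcChord n x y) (arcChord n x′ y′)
arcChord-cross {n} {s} {c} {suc X} {y} {suc X′} {y′} c≤2n arc arc′ x<x′ y<y′ =
  chord-cross n X X′ y y′ (≤-pred x<x′) (≤-trans (Arc.x≤c arc′) (Arc.c≤y arc)) y<y′
    (≤-trans (n≤1+n X) (≤-trans (Arc.x≤c arc) c≤2n))
    (linear-≤ 0 (+-mono-≤ (Arc.y<x+n arc′) (+-mono-≤ (Arc.x≤c arc′) (+-mono-≤ (Arc.c≤y arc) (Arc.y<x+n arc))))
      (solve (X ∷ X′ ∷ y ∷ y′ ∷ c ∷ n ∷ [])))

Concordant : ℕ → (ℕ → ℕ) → (ℕ → ℕ) → Set
Concordant s α β = ∀ i j → 1 ≤ i → j ≤ s → i < j → (α i < α j × β i < β j) ⊎ (α j < α i × β j < β i)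

concordant-arcs-cross : ∀ {n s c} α β → c ≤ n + n → (∀ i → 1 ≤ i → i ≤ s → Arc n s c (α i) (β i)) →
  Concordant s α β → ∀ i j → 1 ≤ i → i ≤ s → 1 ≤ j → j ≤ s → i ≢ j →
  Cross (arcChord n (α i) (β i)) (arcChord n (α j) (β j))
concordant-arcs-cross α β c≤2n arcs conc i j 1≤i i≤s 1≤j j≤s i≢j with <-cmp i j
... | tri≈ _ i≡j _ = ⊥-elim (i≢j i≡j)
... | tri< i<j _ _ with conc i j 1≤i j≤s i<j
...   | inj₁ (α< , β<) = arcChord-cross c≤2n (arcs i 1≤i i≤s) (arcs j 1≤j j≤s) α< β<
...   | inj₂ (α> , β>) = Cross-sym _ _ (arcChord-cross c≤2n (arcs j 1≤j j≤s) (arcs i 1≤i i≤s) α> β>)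
concordant-arcs-cross α β c≤2n arcs conc i j 1≤i i≤s 1≤j j≤s i≢j | tri> _ _ j<i with conc j i 1≤j i≤s j<i
...   | inj₁ (α< , β<) = Cross-sym _ _ (arcChord-cross c≤2n (arcs j 1≤j j≤s) (arcs i 1≤i i≤s) α< β<)
...   | inj₂ (α> , β>) = arcChord-cross c≤2n (arcs i 1≤i i≤s) (arcs j 1≤j j≤s) α> β>

record ArcSystem (n s : ℕ) (a b : ℕ → ℕ) (ℓ : ℕ) : Set where
  field
    c          : ℕ
    α β        : ℕ → ℕ
    c≤2n       : c ≤ n + n
    arcs       : ∀ i → 1 ≤ i → i ≤ s → Arc n s c (α i) (β i)
    concordant : Concordant s α β
    residues   : ∀ i → 1 ≤ i → i ≤ s → md (α i) n ≡ a (md (i + ℓ) s) × md (β i) n ≡ b i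

module _ {n s : ℕ} {a b : ℕ → ℕ} (A : SortedSubset n s a) (B : SortedSubset n s b) (1≤n : 1 ≤ n) where

  unshiftedArcs : Good a b s 0 → ArcSystem n s a b 0
  unshiftedArcs isGood = record
    { c = n + n ; α = λ i → a i + n ; β = λ i → b i + (n + n) ; c≤2n = ≤-refl
    ; arcs = arc ; concordant = concordant ; residues = residues }
    where
    arc : ∀ i → 1 ≤ i → i ≤ s → Arc n s (n + n) (a i + n) (b i + (n + n))
    arc i 1≤i i≤s with m≤n⇒∃[o]m+o≡n i≤s
    ... | d , i+d≡s = record
      { 2≤x   = +-mono-≤ (sorted-pos A 1≤i i≤s) 1≤n
      ; x≤c   = +-monoˡ-≤ n (sorted-≤n A 1≤i i≤s)
      ; c≤y   = m≤n+m (n + n) (b i)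
      ; y<x+n = subst (b i + (n + n) <_) (sym (+-assoc (a i) n n)) (+-monoˡ-< (n + n) b<a)
      ; long  = subst (λ s → a i + n + s ≤ suc (b i + (n + n))) i+d≡s
                  (length-bound (a i) d i (b i) (sorted-room A d 1≤i (≤-reflexive i+d≡s)) (index≤sorted B 1≤i i≤s)) }
      where
      length-bound : ∀ x d i y → x + d ≤ n → i ≤ y → x + n + (i + d) ≤ suc (y + (n + n))
      length-bound x d i y h₁ h₂ = linear-≤ 1 (+-mono-≤ h₁ h₂) (solve (x ∷ d ∷ n ∷ i ∷ y ∷ []))
      b<a : b i < a i
      b<a = subst (λ j → b i < a j) (+-identityʳ i) (isGood i 1≤i (subst (_≤ s) (sym (+-identityʳ i)) i≤s))
    concordant : Concordant s (λ i → a i + n) (λ i → b i + (n + n))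
    concordant i j 1≤i j≤s i<j =
      inj₁ (+-monoˡ-< n (sorted-mono-< A 1≤i i<j j≤s) , +-monoˡ-< (n + n) (sorted-mono-< B 1≤i i<j j≤s))
    residues : ∀ i → 1 ≤ i → i ≤ s → md (a i + n) n ≡ a (md (i + 0) s) × md (b i + (n + n)) n ≡ b i
    residues i 1≤i i≤s rewrite +-identityʳ i | md-id s i 1≤i i≤s =
      trans (md-periodic n (a i)) (sorted-md A 1≤i i≤s) , trans (md-periodic₂ n (b i)) (sorted-md B 1≤i i≤s)

  below+n : ∀ {x y} → x ≤ n → 1 ≤ y → x < y + n
  below+n x≤n 1≤y = +-mono-≤ 1≤y x≤n

  below+2n : ∀ {x y} → x ≤ n → 1 ≤ y → x + n < y + (n + n)
  below+2n {x} {y} x≤n 1≤y = subst (x + n <_) (+-assoc y n n) (+-monoˡ-< n (below+n x≤n 1≤y))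

  -- ℓ = suc L′ is least, so the shift L′ fails at some i₀: the arcs all pass through c = a (i₀ + L′) + n.
  module ShiftedArcs (L′ i₀ : ℕ) (1≤i₀ : 1 ≤ i₀) (m≤s : i₀ + L′ ≤ s) (am≤bi₀ : a (i₀ + L′) ≤ b i₀)
                     (isGood : Good a b s (suc L′)) where

    L m c : ℕ
    L = suc L′
    m = i₀ + L′
    c = a m + n

    α β : ℕ → ℕ
    α i = if i <ᵇ i₀ then a (i + L) + n else if i + L ≤ᵇ s then a (i + L) else a (i + L ∸ s) + n
    β i = if i <ᵇ i₀ then b i + (n + n) else b i + n

    data View (i : ℕ) : ℕ → ℕ → Set where
      before  : i < i₀ → View i (a (i + L) + n) (b i + (n + n))
      middle  : i₀ ≤ i → i + L ≤ s → View i (a (i + L)) (b i + n)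
      wrapped : i₀ ≤ i → s < i + L → View i (a (i + L ∸ s) + n) (b i + n)

    view : ∀ i → View i (α i) (β i)
    view i with i <? i₀
    ... | yes i<i₀ rewrite <ᵇ-true i<i₀ = before i<i₀
    ... | no i≮i₀ with i + L ≤? s
    ...   | yes le rewrite <ᵇ-false (≮⇒≥ i≮i₀) | ≤ᵇ-true le = middle (≮⇒≥ i≮i₀) le
    ...   | no gt rewrite <ᵇ-false (≮⇒≥ i≮i₀) | ≤ᵇ-false (≰⇒> gt) = wrapped (≮⇒≥ i≮i₀) (≰⇒> gt)

    1≤m : 1 ≤ m
    1≤m = ≤-trans 1≤i₀ (m≤m+n i₀ L′)

    1≤i+L : ∀ i → 1 ≤ i + L
    1≤i+L i = subst (1 ≤_) (sym (+-suc i L′)) (s≤s z≤n)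

    before-index : ∀ {i} → i < i₀ → i + L ≤ m
    before-index {i} i<i₀ = subst (_≤ m) (sym (+-suc i L′)) (+-monoˡ-≤ L′ i<i₀)

    L≤m : L ≤ m
    L≤m = +-monoˡ-≤ L′ 1≤i₀

    module Wrapped {i} (i≤s : i ≤ s) (s<i+L : s < i + L) where
      j : ℕ
      j = i + L ∸ s
      1≤j : 1 ≤ j
      1≤j = m<n⇒0<n∸m s<i+L
      j≤L : j ≤ L
      j≤L = m≤n+o⇒m∸n≤o (i + L) s (+-monoˡ-≤ L i≤s)
      j≤m : j ≤ m
      j≤m = ≤-trans j≤L L≤m
      j≤s : j ≤ s
      j≤s = ≤-trans j≤m m≤s
      s+j≡i+L : s + j ≡ i + L
      s+j≡i+L = m+[n∸m]≡n (<⇒≤ s<i+L)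
      md≡j : md (i + L) s ≡ j
      md≡j = md-wrap s (i + L) s<i+L (+-mono-≤ i≤s (≤-trans L≤m m≤s))

    arc : ∀ {i x y} → 1 ≤ i → i ≤ s → View i x y → Arc n s c x y
    arc {i} 1≤i i≤s (before i<i₀) with m≤n⇒∃[o]m+o≡n i<i₀ | m≤n⇒∃[o]m+o≡n m≤s
    ... | d₁ , i₀≡ | d₂ , s≡ = record
      { 2≤x   = +-mono-≤ (sorted-pos A (1≤i+L i) i+L≤s) 1≤n
      ; x≤c   = +-monoˡ-≤ n (sorted-mono-≤ A (1≤i+L i) (before-index i<i₀) m≤s)
      ; c≤y   = ≤-trans (+-monoˡ-≤ n (sorted-≤n A 1≤m m≤s)) (m≤n+m (n + n) (b i))
      ; y<x+n = subst (b i + (n + n) <_) (sym (+-assoc (a (i + L)) n n)) (+-monoˡ-< (n + n) (isGood i 1≤i i+L≤s))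
      ; long  = subst (λ s → a (i + L) + n + s ≤ suc (b i + (n + n))) (trans (cong (λ z → z + L′ + d₂) i₀≡) s≡)
                  (length-bound (a (i + L)) d₁ d₂ (a m) (b i₀) (b i) i
                    (subst (λ z → a (i + L) + d₁ ≤ a z) i+L+d₁≡m
                      (sorted-spread A d₁ (1≤i+L i) (subst (_≤ s) (sym i+L+d₁≡m) m≤s)))
                    am≤bi₀
                    (sorted-room B (L′ + d₂) 1≤i₀ (≤-reflexive (trans (sym (+-assoc i₀ L′ d₂)) s≡)))
                    (index≤sorted B 1≤i i≤s)) }
      where
      i+L≤s : i + L ≤ s
      i+L≤s = ≤-trans (before-index i<i₀) m≤s
      i+L+d₁≡m : i + L + d₁ ≡ m
      i+L+d₁≡m = trans (rearrange i L′ d₁) (cong (_+ L′) i₀≡)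
        where
        rearrange : ∀ i L′ d₁ → i + suc L′ + d₁ ≡ suc i + d₁ + L′
        rearrange = solve-∀
      length-bound : ∀ x d₁ d₂ am bi₀ bi i → x + d₁ ≤ am → am ≤ bi₀ → bi₀ + (L′ + d₂) ≤ n → i ≤ bi →
        x + n + (suc i + d₁ + L′ + d₂) ≤ suc (bi + (n + n))
      length-bound x d₁ d₂ am bi₀ bi i h₁ h₂ h₃ h₄ =
        linear-≤ 0 (+-mono-≤ h₁ (+-mono-≤ h₂ (+-mono-≤ h₃ h₄))) (solve (x ∷ d₁ ∷ d₂ ∷ am ∷ bi₀ ∷ bi ∷ i ∷ L′ ∷ n ∷ []))
    arc {i} 1≤i i≤s (middle i₀≤i i+L≤s) with m≤n⇒∃[o]m+o≡n i+L≤s | m≤n⇒∃[o]m+o≡n i₀≤i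
    ... | d₃ , s≡ | d₄ , i≡ = record
      { 2≤x   = ≤-trans (s≤s (sorted-pos B 1≤i i≤s)) (isGood i 1≤i i+L≤s)
      ; x≤c   = ≤-trans (sorted-≤n A (1≤i+L i) i+L≤s) (m≤n+m n (a m))
      ; c≤y   = +-monoˡ-≤ n am≤bi
      ; y<x+n = +-monoˡ-< n (isGood i 1≤i i+L≤s)
      ; long  = subst (λ s → a (i + L) + s ≤ suc (b i + n)) (trans (cong (λ z → z + L + d₃) i≡) s≡)
                  (length-bound (a (i + L)) d₃ d₄ (a m) (b i₀) (b i)
                    (sorted-room A d₃ (1≤i+L i) (≤-reflexive s≡))
                    (index≤sorted A 1≤m m≤s)
                    am≤bi₀
                    (subst (λ z → b i₀ + d₄ ≤ b z) i≡ (sorted-spread B d₄ 1≤i₀ (subst (_≤ s) (sym i≡) i≤s)))) }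
      where
      am≤bi : a m ≤ b i
      am≤bi = ≤-trans am≤bi₀ (sorted-mono-≤ B 1≤i₀ i₀≤i i≤s)
      length-bound : ∀ x d₃ d₄ am bi₀ bi → x + d₃ ≤ n → i₀ + L′ ≤ am → am ≤ bi₀ → bi₀ + d₄ ≤ bi →
        x + (i₀ + d₄ + suc L′ + d₃) ≤ suc (bi + n)
      length-bound x d₃ d₄ am bi₀ bi h₁ h₂ h₃ h₄ =
        linear-≤ 0 (+-mono-≤ h₁ (+-mono-≤ h₂ (+-mono-≤ h₃ h₄))) (solve (x ∷ d₃ ∷ d₄ ∷ am ∷ bi₀ ∷ bi ∷ i₀ ∷ L′ ∷ n ∷ []))
    arc {i} 1≤i i≤s (wrapped i₀≤i s<i+L) with m≤n⇒∃[o]m+o≡n j≤m | m≤n⇒∃[o]m+o≡n i₀≤i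
      where open Wrapped i≤s s<i+L
    ... | d₅ , m≡ | d₄ , i≡ = record
      { 2≤x   = +-mono-≤ (sorted-pos A 1≤j j≤s) 1≤n
      ; x≤c   = +-monoˡ-≤ n (sorted-mono-≤ A 1≤j j≤m m≤s)
      ; c≤y   = +-monoˡ-≤ n am≤bi
      ; y<x+n = subst (b i + n <_) (sym (+-assoc (a j) n n)) (below+2n (sorted-≤n B 1≤i i≤s) (sorted-pos A 1≤j j≤s))
      ; long  = length-bound (a j) j d₄ d₅ (a m) (b i₀) (b i)
                  (≤-reflexive (sym m≡))
                  (≤-reflexive (trans s+j≡i+L (cong (_+ L) (sym i≡))))
                  (subst (λ z → a j + d₅ ≤ a z) m≡ (sorted-spread A d₅ 1≤j (subst (_≤ s) (sym m≡) m≤s)))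
                  am≤bi₀
                  (subst (λ z → b i₀ + d₄ ≤ b z) i≡ (sorted-spread B d₄ 1≤i₀ (subst (_≤ s) (sym i≡) i≤s))) }
      where
      open Wrapped i≤s s<i+L
      am≤bi : a m ≤ b i
      am≤bi = ≤-trans am≤bi₀ (sorted-mono-≤ B 1≤i₀ i₀≤i i≤s)
      length-bound : ∀ x j d₄ d₅ am bi₀ bi → i₀ + L′ ≤ j + d₅ → s + j ≤ i₀ + d₄ + suc L′ → x + d₅ ≤ am →
        am ≤ bi₀ → bi₀ + d₄ ≤ bi → x + n + s ≤ suc (bi + n)
      length-bound x j d₄ d₅ am bi₀ bi h₁ h₂ h₃ h₄ h₅ =
        linear-≤ 0 (+-mono-≤ h₁ (+-mono-≤ h₂ (+-mono-≤ h₃ (+-mono-≤ h₄ h₅))))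
          (solve (x ∷ j ∷ s ∷ d₄ ∷ d₅ ∷ am ∷ bi₀ ∷ bi ∷ i₀ ∷ L′ ∷ n ∷ []))

    residue : ∀ {i x y} → 1 ≤ i → i ≤ s → View i x y → md x n ≡ a (md (i + L) s) × md y n ≡ b i
    residue {i} 1≤i i≤s (before i<i₀) rewrite md-id s (i + L) (1≤i+L i) (≤-trans (before-index i<i₀) m≤s) =
      trans (md-periodic n _) (sorted-md A (1≤i+L i) (≤-trans (before-index i<i₀) m≤s))
      , trans (md-periodic₂ n (b i)) (sorted-md B 1≤i i≤s)
    residue {i} 1≤i i≤s (middle _ i+L≤s) rewrite md-id s (i + L) (1≤i+L i) i+L≤s =
      sorted-md A (1≤i+L i) i+L≤s , trans (md-periodic n (b i)) (sorted-md B 1≤i i≤s)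
    residue {i} 1≤i i≤s (wrapped _ s<i+L) rewrite Wrapped.md≡j i≤s s<i+L =
      trans (md-periodic n (a j)) (sorted-md A 1≤j j≤s) , trans (md-periodic n (b i)) (sorted-md B 1≤i i≤s)
      where open Wrapped i≤s s<i+L

    -- Both coordinates increase along the cyclic order i₀, …, s, 1, …, i₀ − 1 of the indices.
    concordant-views : ∀ {i j x y x′ y′} → 1 ≤ i → j ≤ s → i < j → View i x y → View j x′ y′ →
      (x < x′ × y < y′) ⊎ (x′ < x × y′ < y)
    concordant-views {i} {j} 1≤i j≤s i<j (before _) (before j<i₀) =
      inj₁ ( +-monoˡ-< n (sorted-mono-< A (1≤i+L i) (+-monoˡ-< L i<j) (≤-trans (before-index j<i₀) m≤s))
           , +-monoˡ-< (n + n) (sorted-mono-< B 1≤i i<j j≤s))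
    concordant-views {i} {j} 1≤i j≤s i<j (before i<i₀) (middle _ j+L≤s) =
      inj₂ ( below+n (sorted-≤n A (1≤i+L j) j+L≤s) (sorted-pos A (1≤i+L i) (≤-trans (before-index i<i₀) m≤s))
           , below+2n (sorted-≤n B (≤-trans 1≤i (<⇒≤ i<j)) j≤s) (sorted-pos B 1≤i (≤-trans (<⇒≤ i<j) j≤s)))
    concordant-views {i} {j} 1≤i j≤s i<j (before i<i₀) (wrapped _ s<j+L) =
      inj₂ ( +-monoˡ-< n (sorted-mono-< A W.1≤j (≤-<-trans W.j≤L (m<n+m L 1≤i)) (≤-trans (before-index i<i₀) m≤s))
           , below+2n (sorted-≤n B (≤-trans 1≤i (<⇒≤ i<j)) j≤s) (sorted-pos B 1≤i (≤-trans (<⇒≤ i<j) j≤s)))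
      where module W = Wrapped j≤s s<j+L
    concordant-views 1≤i j≤s i<j (middle i₀≤i _) (before j<i₀) = ⊥-elim (<-asym j<i₀ (≤-<-trans i₀≤i i<j))
    concordant-views 1≤i j≤s i<j (wrapped i₀≤i _) (before j<i₀) = ⊥-elim (<-asym j<i₀ (≤-<-trans i₀≤i i<j))
    concordant-views {i} {j} 1≤i j≤s i<j (middle _ _) (middle _ j+L≤s) =
      inj₁ (sorted-mono-< A (1≤i+L i) (+-monoˡ-< L i<j) j+L≤s , +-monoˡ-< n (sorted-mono-< B 1≤i i<j j≤s))
    concordant-views {i} {j} 1≤i j≤s i<j (middle _ i+L≤s) (wrapped _ s<j+L) =
      inj₁ (below+n (sorted-≤n A (1≤i+L i) i+L≤s) (sorted-pos A W.1≤j W.j≤s) , +-monoˡ-< n (sorted-mono-< B 1≤i i<j j≤s))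
      where module W = Wrapped j≤s s<j+L
    concordant-views 1≤i j≤s i<j (wrapped _ s<i+L) (middle _ j+L≤s) =
      ⊥-elim (<-irrefl refl (<-≤-trans s<i+L (≤-trans (+-monoˡ-≤ L (<⇒≤ i<j)) j+L≤s)))
    concordant-views {i} {j} 1≤i j≤s i<j (wrapped _ s<i+L) (wrapped _ s<j+L) =
      inj₁ ( +-monoˡ-< n (sorted-mono-< A Wi.1≤j (∸-monoˡ-< (+-monoˡ-< L i<j) (<⇒≤ s<i+L)) Wj.j≤s)
           , +-monoˡ-< n (sorted-mono-< B 1≤i i<j j≤s))
      where
      module Wi = Wrapped (≤-trans (<⇒≤ i<j) j≤s) s<i+L
      module Wj = Wrapped j≤s s<j+L

    system : ArcSystem n s a b L
    system = record
      { c = c ; α = α ; β = β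
      ; c≤2n = +-monoˡ-≤ n (sorted-≤n A 1≤m m≤s)
      ; arcs = λ i 1≤i i≤s → arc 1≤i i≤s (view i)
      ; concordant = λ i j 1≤i j≤s i<j → concordant-views 1≤i j≤s i<j (view i) (view j)
      ; residues = λ i 1≤i i≤s → residue 1≤i i≤s (view i) }

  arcSystem : ArcSystem n s a b (leastℓ a b s)
  arcSystem with leastℓ a b s in least | LeastGoodFrom.isGood (leastℓ-spec a b s)
  ... | zero  | isGood = unshiftedArcs isGood
  ... | suc L′ | isGood with leastℓ-suc a b s L′ least
  ...   | i₀ , 1≤i₀ , m≤s , am≤bi₀ = ShiftedArcs.system L′ i₀ 1≤i₀ m≤s am≤bi₀ isGood

module _ {n k : ℕ} {a b : ℕ → ℕ} (A : SortedSubset n (suc k) a) (B : SortedSubset n (suc k) b) (1≤n : 1 ≤ n) where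

  open ArcSystem (arcSystem A B 1≤n)

  generatorChord : ℕ → Segment
  generatorChord i = arcChord n (α i) (β i)

  generatorChord-Ω-Ψ : ∀ i → 1 ≤ i → i ≤ suc k →
    InΩ n k (generatorChord i) × Ψ n (generatorChord i) ≡ (a (md (i + leastℓ a b (suc k)) (suc k)) , b i)
  generatorChord-Ω-Ψ i 1≤i i≤s with arcChord-Ω 1≤n c≤2n (arcs i 1≤i i≤s) | residues i 1≤i i≤s
  ... | isSegment , long , Ψ≡ | α≡ , β≡ = (isSegment , long) , trans Ψ≡ (cong₂ _,_ α≡ β≡)

  generator-variables : ∀ p q → InN a b (suc k) p q → InRing n k p q
  generator-variables p q (i , 1≤i , i≤s , refl , refl) = generatorChord i , generatorChord-Ω-Ψ i 1≤i i≤s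

  generator⇒crossing : ∀ e → (∀ p q → InN a b (suc k) p q → 1 ≤ e p q) → SupportHasCrossing n k e
  generator⇒crossing e divides = σ , inSupport , crossing
    where
    index : Fin (suc k) → ℕ
    index r = suc (toℕ r)
    σ : Fin (suc k) → Segment
    σ = generatorChord ∘ index
    inSupport : ∀ r → InΩ n k (σ r) × 1 ≤ e (proj₁ (Ψ n (σ r))) (proj₂ (Ψ n (σ r)))
    inSupport r with generatorChord-Ω-Ψ (index r) (s≤s z≤n) (toℕ<n r)
    ... | inΩ , Ψ≡ rewrite Ψ≡ = inΩ , divides _ _ (index r , s≤s z≤n , toℕ<n r , refl , refl)
    crossing : ∀ r t → r ≢ t → Cross (σ r) (σ t)
    crossing r t r≢t = concordant-arcs-cross α β c≤2n arcs concordant (index r) (index t)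
      (s≤s z≤n) (toℕ<n r) (s≤s z≤n) (toℕ<n t) (λ eq → r≢t (toℕ-injective (suc-injective eq)))

-- The segment {x < y} or its rotated copy {y − n, x + n} (unreduced), whichever spans at most n.
orbitStart orbitEnd : ℕ → ℕ → ℕ → ℕ
orbitStart n x y = if (y ∸ x) ≤ᵇ n then x else y ∸ n
orbitEnd   n x y = if (y ∸ x) ≤ᵇ n then y else x + n

data OrbitView (n x y : ℕ) : ℕ → ℕ → Set where
  short : y ≤ x + n → OrbitView n x y x y
  long  : ∀ u → x < u → u + n ≡ y → OrbitView n x y u (x + n)

orbitView : ∀ n x y → OrbitView n x y (orbitStart n x y) (orbitEnd n x y)
orbitView n x y with (y ∸ x) ≤ᵇ n in eq
... | true  = short (≤-trans (m≤n+m∸n y x) (+-monoʳ-≤ x (≤ᵇ⇒≤ _ _ (subst T (sym eq) _))))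
... | false = long (y ∸ n) x<y∸n (m∸n+n≡m (≤-trans (m≤m+n n x) (≤-trans (n≤1+n _) n+x<y)))
  where
  n<d : n < y ∸ x
  n<d = ≰⇒> (λ d≤n → subst T eq (≤⇒≤ᵇ d≤n))
  x<y : x < y
  x<y = m∸n≢0⇒n<m (λ d≡0 → <⇒≱ n<d (subst (_≤ n) (sym d≡0) z≤n))
  n+x<y : suc n + x ≤ y
  n+x<y = m≤o∸n⇒m+n≤o (suc n) (<⇒≤ x<y) n<d
  x<y∸n : x < y ∸ n
  x<y∸n = m+n≤o⇒m≤o∸n (suc x) (subst (_≤ y) (cong suc (+-comm n x)) n+x<y)

Ψ-orbitView : ∀ {n x y u v} → OrbitView n x y u v → Ψ n (x , y) ≡ (md (suc u) n , md v n)
Ψ-orbitView {n} {x} {y} (short y≤x+n) =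
  trans (Ψ-short n x y (m≤n+o⇒m∸n≤o y x y≤x+n)) (cong (λ z → md z n , md y n) (+-comm x 1))
Ψ-orbitView {n} {x} (long u x<u refl) = trans (Ψ-long n x (u + n) n<d)
  (cong₂ _,_ (trans (cong (λ z → md z n) (+-comm-middle u n 1)) (md-periodic n (suc u))) (sym (md-periodic n x)))
  where
  n<d : n < u + n ∸ x
  n<d = subst (n <_) (sym (+-∸-comm n (<⇒≤ x<u))) (m<n+m n (m<n⇒0<n∸m x<u))
  +-comm-middle : ∀ u n k → u + n + k ≡ k + u + n
  +-comm-middle = solve-∀

Ψ-orbit : ∀ n x y → Ψ n (x , y) ≡ (md (suc (orbitStart n x y)) n , md (orbitEnd n x y) n)
Ψ-orbit n x y = Ψ-orbitView (orbitView n x y)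

module _ {n : ℕ} where

  orbitView-span : ∀ {x y u v} → OrbitView n x y u v → v ≤ u + n
  orbitView-span (short y≤x+n)   = y≤x+n
  orbitView-span (long u x<u _) = +-monoˡ-≤ n (<⇒≤ x<u)

  orbitView-start-mono : ∀ {x y u v x′ y′ u′ v′} → OrbitView n x y u v → OrbitView n x′ y′ u′ v′ →
    x < x′ → y < y′ → u < u′
  orbitView-start-mono (short _)          (short _)            x<x′ _ = x<x′
  orbitView-start-mono (short _)          (long u′ x′<u′ _)    x<x′ _ = <-trans x<x′ x′<u′
  orbitView-start-mono (long u _ refl)    (short y′≤x′+n)      _ y<y′ = +-cancelʳ-< n u _ (<-≤-trans y<y′ y′≤x′+n)
  orbitView-start-mono (long u _ refl)    (long u′ _ refl)     _ y<y′ = +-cancelʳ-< n u u′ y<y′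

  orbitView-end-mono : ∀ {x y u v x′ y′ u′ v′} → OrbitView n x y u v → OrbitView n x′ y′ u′ v′ →
    x < x′ → y < y′ → v < v′
  orbitView-end-mono (short _)          (short _)        _ y<y′ = y<y′
  orbitView-end-mono (short y≤x+n)      (long _ _ _)     x<x′ _ = ≤-<-trans y≤x+n (+-monoˡ-< n x<x′)
  orbitView-end-mono (long u x<u refl)  (short _)        _ y<y′ = <-trans (+-monoˡ-< n x<u) y<y′
  orbitView-end-mono (long _ _ _)       (long _ _ _)     x<x′ _ = +-monoˡ-< n x<x′

  orbitView-end-bounds : ∀ {x y u v} → 1 ≤ n → x < y → y ≤ n + n → OrbitView n x y u v → 1 ≤ v × v ≤ n + n
  orbitView-end-bounds 1≤n x<y y≤2n (short _)          = ≤-trans (s≤s z≤n) x<y , y≤2n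
  orbitView-end-bounds 1≤n x<y y≤2n (long u x<u refl) = ≤-trans 1≤n (m≤n+m n _) , ≤-trans (+-monoˡ-≤ n (<⇒≤ x<u)) y≤2n

  below-3n : ∀ {y x₁} → y ≤ n + n → 1 ≤ x₁ → y < x₁ + n + n
  below-3n {y} {x₁} y≤2n 1≤x₁ = subst (y <_) (sym (+-assoc x₁ n n)) (+-mono-≤ 1≤x₁ y≤2n)

  -- The last and the first segment of a crossing, seen one turn apart.
  orbitView-start-wrap : ∀ {x y u v x₁ y₁ u₁ v₁} → OrbitView n x y u v → OrbitView n x₁ y₁ u₁ v₁ →
    x < y₁ → 1 ≤ x₁ → y ≤ n + n → u < u₁ + n
  orbitView-start-wrap (short _)       (short y₁≤x₁+n)   x<y₁ _ _ = <-≤-trans x<y₁ y₁≤x₁+n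
  orbitView-start-wrap (long u _ refl) (short _)         _ 1≤x₁ y≤2n = +-mono-≤ 1≤x₁ (+-cancelʳ-≤ n u n y≤2n)
  orbitView-start-wrap (short _)       (long u₁ _ refl)  x<y₁ _ _ = x<y₁
  orbitView-start-wrap (long u _ refl) (long u₁ x₁<u₁ _) _ 1≤x₁ y≤2n =
    +-mono-≤ (≤-trans 1≤x₁ (<⇒≤ x₁<u₁)) (+-cancelʳ-≤ n u n y≤2n)

  orbitView-end-wrap : ∀ {x y u v x₁ y₁ u₁ v₁} → OrbitView n x y u v → OrbitView n x₁ y₁ u₁ v₁ →
    x < y₁ → 1 ≤ x₁ → y ≤ n + n → v < v₁ + n
  orbitView-end-wrap (short y≤x+n)     (short _)    x<y₁ _ _      = ≤-<-trans y≤x+n (+-monoˡ-< n x<y₁)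
  orbitView-end-wrap (short _)         (long _ _ _) _ 1≤x₁ y≤2n   = below-3n y≤2n 1≤x₁
  orbitView-end-wrap (long _ _ _)      (short _)    x<y₁ _ _      = +-monoˡ-< n x<y₁
  orbitView-end-wrap (long u x<u refl) (long _ _ _) _ 1≤x₁ y≤2n   = <-trans (+-monoˡ-< n x<u) (below-3n y≤2n 1≤x₁)

rotate : (ℕ → ℕ) → ℕ → ℕ → ℕ → ℕ → ℕ
rotate f n s t j = if j + t ≤ᵇ s then f (j + t) else f (j + t ∸ s) + n

rotate-≤ : ∀ f n s t j → j + t ≤ s → rotate f n s t j ≡ f (j + t)
rotate-≤ f n s t j j+t≤s rewrite ≤ᵇ-true j+t≤s = refl

rotate-> : ∀ f n s t j → s < j + t → rotate f n s t j ≡ f (j + t ∸ s) + n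
rotate-> f n s t j s<j+t rewrite ≤ᵇ-false s<j+t = refl

rotate-last : ∀ f n s t → 1 ≤ t → t ≤ s → rotate f n s t s ≡ f t + n
rotate-last f n s t 1≤t t≤s = trans (rotate-> f n s t s (m<m+n s 1≤t)) (cong (λ i → f i + n) (m+n∸m≡n s t))

rotate-full : ∀ f n s → rotate f n s s 1 ≡ f 1 + n
rotate-full f n s = trans (rotate-> f n s s 1 ≤-refl) (cong (λ i → f i + n) (m+n∸n≡m 1 s))

rotate-increasing : ∀ f n s t → t ≤ s → Increasing s f → f s < f 1 + n → Increasing s (rotate f n s t)
rotate-increasing f n s t t≤s inc wrap i 1≤i i<s with suc i + t ≤? s | i + t ≤? s
... | yes i+1+t≤s | _ rewrite rotate-≤ f n s t i (≤-trans (n≤1+n _) i+1+t≤s) | rotate-≤ f n s t (suc i) i+1+t≤s =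
  inc (i + t) (≤-trans 1≤i (m≤m+n i t)) i+1+t≤s
... | no i+1+t≰s | yes i+t≤s rewrite rotate-≤ f n s t i i+t≤s | rotate-> f n s t (suc i) (≰⇒> i+1+t≰s) =
  subst (λ k → f k < f (suc k ∸ s) + n) (sym (≤-antisym i+t≤s (≤-pred (≰⇒> i+1+t≰s))))
    (subst (λ k → f s < f k + n) (sym (m+n∸n≡m 1 s)) wrap)
... | no _ | no i+t≰s rewrite rotate-> f n s t i (≰⇒> i+t≰s) | rotate-> f n s t (suc i) (<-trans (≰⇒> i+t≰s) ≤-refl)
                            | +-∸-assoc 1 {i + t} {s} (<⇒≤ (≰⇒> i+t≰s)) =
  +-monoˡ-< n (inc (i + t ∸ s) (m<n⇒0<n∸m (≰⇒> i+t≰s))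
    (subst (_≤ s) (+-∸-assoc 1 (<⇒≤ (≰⇒> i+t≰s))) (≤-trans (m≤n+o⇒m∸n≤o (suc i + t) s (+-monoˡ-≤ t i<s)) t≤s)))

rotate-pointwise : ∀ f g n s t → (∀ j → 1 ≤ j → j ≤ s → g j < f j + n) → t ≤ s →
  ∀ j → 1 ≤ j → j ≤ s → rotate g n s t j < rotate f n s t j + n
rotate-pointwise f g n s t g<f+n t≤s j 1≤j j≤s with j + t ≤? s
... | yes j+t≤s rewrite rotate-≤ f n s t j j+t≤s | rotate-≤ g n s t j j+t≤s =
  g<f+n (j + t) (≤-trans 1≤j (m≤m+n j t)) j+t≤s
... | no j+t≰s rewrite rotate-> f n s t j (≰⇒> j+t≰s) | rotate-> g n s t j (≰⇒> j+t≰s) =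
  +-monoˡ-< n (g<f+n (j + t ∸ s) (m<n⇒0<n∸m (≰⇒> j+t≰s)) (m≤n+o⇒m∸n≤o (j + t) s (+-mono-≤ j≤s t≤s)))

md-rotate : ∀ f n s t j → 1 ≤ j → j ≤ s → t ≤ s → md (rotate f n s t j) n ≡ md (f (md (j + t) s)) n
md-rotate f n s t j 1≤j j≤s t≤s with j + t ≤? s
... | yes j+t≤s rewrite rotate-≤ f n s t j j+t≤s | md-id s (j + t) (≤-trans 1≤j (m≤m+n j t)) j+t≤s = refl
... | no j+t≰s rewrite rotate-> f n s t j (≰⇒> j+t≰s) | md-wrap s (j + t) (≰⇒> j+t≰s) (+-mono-≤ j≤s t≤s) =
  md-periodic n _

switch-point : ∀ (P : ℕ → Set) → (∀ j → Dec (P j)) → ∀ {s} → 1 ≤ s → P 1 → ¬ P s →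
  ∃[ t ] (1 ≤ t × t < s × P t × ¬ P (suc t))
switch-point P P? {suc s} _ = scan s
  where
  scan : ∀ s → P 1 → ¬ P (suc s) → ∃[ t ] (1 ≤ t × t < suc s × P t × ¬ P (suc t))
  scan zero    p₁ ¬p₁ = ⊥-elim (¬p₁ p₁)
  scan (suc s) p₁ ¬pₛ₊₂ with P? (suc s)
  ... | yes pₛ₊₁ = suc s , s≤s z≤n , ≤-refl , pₛ₊₁ , ¬pₛ₊₂
  ... | no ¬pₛ₊₁ with scan s p₁ ¬pₛ₊₁
  ...   | t , 1≤t , t<s , pₜ , ¬pₜ₊₁ = t , 1≤t , m≤n⇒m≤1+n t<s , pₜ , ¬pₜ₊₁

record SortedCrossing (n s : ℕ) (x y : ℕ → ℕ) : Set where
  field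
    x-increasing : Increasing s x
    y-increasing : Increasing s y
    xₛ<y₁        : x s < y 1
    1≤x₁         : 1 ≤ x 1
    yₛ≤2n        : y s ≤ n + n

record Interlaced (n s : ℕ) (α β : ℕ → ℕ) : Set where
  field
    α-increasing : Increasing s α
    β-increasing : Increasing s β
    αₛ≤β₁        : α s ≤ β 1
    β<α+n        : ∀ j → 1 ≤ j → j ≤ s → β j < α j + n
    1≤β₁         : 1 ≤ β 1
    β₁≤3n        : β 1 ≤ n + n + n

Realizes : ℕ → ℕ → (ℕ → ℕ) → (ℕ → ℕ) → (ℕ → ℕ) → (ℕ → ℕ) → Set
Realizes n s x y α β = ∀ j → 1 ≤ j → j ≤ s → ∃[ r ] (1 ≤ r × r ≤ s × Ψ n (x r , y r) ≡ (md (α j) n , md (β j) n))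

module _ {n s : ℕ} {x y : ℕ → ℕ} (1≤n : 1 ≤ n) (1≤s : 1 ≤ s) (crossing : SortedCrossing n s x y) where

  open SortedCrossing crossing

  private
    u v : ℕ → ℕ
    u r = orbitStart n (x r) (y r)
    v r = orbitEnd n (x r) (y r)

    view : ∀ r → OrbitView n (x r) (y r) (u r) (v r)
    view r = orbitView n (x r) (y r)

    x<y : ∀ {r} → 1 ≤ r → r ≤ s → x r < y r
    x<y 1≤r r≤s = ≤-<-trans (increasing-mono-≤ x x-increasing 1≤r r≤s ≤-refl)
                    (<-≤-trans xₛ<y₁ (increasing-mono-≤ y y-increasing ≤-refl 1≤r r≤s))

    y≤2n : ∀ {r} → 1 ≤ r → r ≤ s → y r ≤ n + n
    y≤2n 1≤r r≤s = ≤-trans (increasing-mono-≤ y y-increasing 1≤r r≤s ≤-refl) yₛ≤2n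

    Short : ℕ → Set
    Short r = y r ≤ x r + n

    short-view : ∀ {r u′ v′} → OrbitView n (x r) (y r) u′ v′ → Short r → u′ ≡ x r × v′ ≡ y r
    short-view (short _)          _       = refl , refl
    short-view (long u x<u u+n≡y) isShort = ⊥-elim (<⇒≱ (subst (_ <_) u+n≡y (+-monoˡ-< n x<u)) isShort)

    long-view : ∀ {r u′ v′} → OrbitView n (x r) (y r) u′ v′ → ¬ Short r → u′ + n ≡ y r × v′ ≡ x r + n
    long-view (short isShort)  ¬short = ⊥-elim (¬short isShort)
    long-view (long u _ u+n≡y) _      = u+n≡y , refl

    u-increasing : Increasing s u
    u-increasing i 1≤i i<s =
      orbitView-start-mono (view i) (view (suc i)) (x-increasing i 1≤i i<s) (y-increasing i 1≤i i<s)

    v-increasing : Increasing s v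
    v-increasing i 1≤i i<s =
      orbitView-end-mono (view i) (view (suc i)) (x-increasing i 1≤i i<s) (y-increasing i 1≤i i<s)

  -- The rotation point: where the crossing passes from short to long segments or back.
  record Switch (t : ℕ) : Set where
    field
      1≤t   : 1 ≤ t
      t≤s   : t ≤ s
      jumps : u t + n < rotate v n s t 1

  switch : ∃ Switch
  switch with y 1 ≤? x 1 + n | y s ≤? x s + n
  ... | yes short₁ | yes shortₛ = s , record { 1≤t = 1≤s ; t≤s = ≤-refl ; jumps = jumps }
    where
    jumps : u s + n < rotate v n s s 1
    jumps rewrite rotate-full v n s | proj₁ (short-view (view s) shortₛ) | proj₂ (short-view (view 1) short₁) =
      +-monoˡ-< n xₛ<y₁
  ... | no long₁ | no longₛ = s , record { 1≤t = 1≤s ; t≤s = ≤-refl ; jumps = jumps }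
    where
    jumps : u s + n < rotate v n s s 1
    jumps rewrite rotate-full v n s | proj₁ (long-view (view s) longₛ) | proj₂ (long-view (view 1) long₁) =
      subst (y s <_) (sym (+-assoc (x 1) n n)) (+-mono-≤ 1≤x₁ yₛ≤2n)
  ... | yes short₁ | no longₛ with switch-point Short (λ r → y r ≤? x r + n) 1≤s short₁ longₛ
  ...   | t , 1≤t , t<s , shortₜ , longₜ₊₁ = t , record { 1≤t = 1≤t ; t≤s = <⇒≤ t<s ; jumps = jumps }
    where
    jumps : u t + n < rotate v n s t 1
    jumps rewrite rotate-≤ v n s t 1 t<s | proj₁ (short-view (view t) shortₜ)
                | proj₂ (long-view (view (suc t)) longₜ₊₁) =
      +-monoˡ-< n (x-increasing t 1≤t t<s)
  switch | no long₁ | yes shortₛ with switch-point (¬_ ∘ Short) (λ r → ¬? (y r ≤? x r + n)) 1≤s long₁ (λ ¬s → ¬s shortₛ)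
  ...   | t , 1≤t , t<s , longₜ , ¬longₜ₊₁ = t , record { 1≤t = 1≤t ; t≤s = <⇒≤ t<s ; jumps = jumps }
    where
    shortₜ₊₁ : Short (suc t)
    shortₜ₊₁ = decidable-stable (y (suc t) ≤? x (suc t) + n) ¬longₜ₊₁
    jumps : u t + n < rotate v n s t 1
    jumps rewrite rotate-≤ v n s t 1 t<s | proj₁ (long-view (view t) longₜ)
                | proj₂ (short-view (view (suc t)) shortₜ₊₁) =
      y-increasing t 1≤t t<s

  interlacedLift : ∃[ α ] ∃[ β ] (Interlaced n s α β × Realizes n s x y α β)
  interlacedLift with switch
  ... | t , record { 1≤t = 1≤t ; t≤s = t≤s ; jumps = jumps } = α , β , interlaced , realizes
    where
    u₊ α β : ℕ → ℕ
    u₊ r = suc (u r)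
    α = rotate u₊ n s t
    β = rotate v n s t
    β₁-bounds : 1 ≤ β 1 × β 1 ≤ n + n + n
    β₁-bounds with suc t ≤? s
    ... | yes t<s rewrite rotate-≤ v n s t 1 t<s
      with orbitView-end-bounds 1≤n (x<y (s≤s z≤n) t<s) (y≤2n (s≤s z≤n) t<s) (view (suc t))
    ...   | 1≤v , v≤2n = 1≤v , ≤-trans v≤2n (m≤m+n (n + n) n)
    β₁-bounds | no t≮s rewrite rotate-> v n s t 1 (≰⇒> t≮s) | ≤-antisym t≤s (≮⇒≥ t≮s) | m+n∸n≡m 1 s
      with orbitView-end-bounds 1≤n (x<y ≤-refl 1≤s) (y≤2n ≤-refl 1≤s) (view 1)
    ...   | 1≤v , v≤2n = ≤-trans 1≤v (m≤m+n _ n) , +-monoˡ-≤ n v≤2n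
    interlaced : Interlaced n s α β
    interlaced = record
      { α-increasing = rotate-increasing u₊ n s t t≤s (λ i 1≤i i<s → s≤s (u-increasing i 1≤i i<s))
                         (s≤s (orbitView-start-wrap (view s) (view 1) xₛ<y₁ 1≤x₁ yₛ≤2n))
      ; β-increasing = rotate-increasing v n s t t≤s v-increasing
                         (orbitView-end-wrap (view s) (view 1) xₛ<y₁ 1≤x₁ yₛ≤2n)
      ; αₛ≤β₁ = subst (_≤ β 1) (sym (rotate-last u₊ n s t 1≤t t≤s)) jumps
      ; β<α+n = rotate-pointwise u₊ v n s t (λ j _ _ → s≤s (orbitView-span (view j))) t≤s
      ; 1≤β₁ = proj₁ β₁-bounds
      ; β₁≤3n = proj₂ β₁-bounds }
    realizes : Realizes n s x y α β
    realizes j 1≤j j≤s = r , proj₁ (md-bounds (j + t) s 1≤s) , proj₂ (md-bounds (j + t) s 1≤s) ,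
      trans (Ψ-orbit n (x r) (y r)) (sym (cong₂ _,_ (md-rotate u₊ n s t j 1≤j j≤s t≤s) (md-rotate v n s t j 1≤j j≤s t≤s)))
      where
      r : ℕ
      r = md (j + t) s

record SortedResidues (n s : ℕ) (α β : ℕ → ℕ) : Set where
  field
    A B      : ℕ → ℕ
    A-sorted : SortedSubset n s A
    B-sorted : SortedSubset n s B
    matching : ∀ i → 1 ≤ i → i ≤ s →
      ∃[ j ] (1 ≤ j × j ≤ s × A (md (i + leastℓ A B s) s) ≡ md (α j) n × B i ≡ md (β j) n)

sortedResidues-cong : ∀ {n s α β α′ β′} → (∀ j → 1 ≤ j → j ≤ s → md (α′ j) n ≡ md (α j) n × md (β′ j) n ≡ md (β j) n) →
  SortedResidues n s α′ β′ → SortedResidues n s α β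
sortedResidues-cong same R = record
  { A = A ; B = B ; A-sorted = A-sorted ; B-sorted = B-sorted
  ; matching = λ i 1≤i i≤s → let j , 1≤j , j≤s , A≡ , B≡ = matching i 1≤i i≤s
                              in j , 1≤j , j≤s , trans A≡ (proj₁ (same j 1≤j j≤s)) , trans B≡ (proj₂ (same j 1≤j j≤s)) }
  where open SortedResidues R

threshold-split : ∀ {s} f → Increasing s f → ∀ T →
  ∃[ τ ] (τ ≤ s × (∀ j → 1 ≤ j → j ≤ τ → f j ≤ T) × (∀ j → τ < j → j ≤ s → T < f j))
threshold-split {zero} f inc T = 0 , z≤n , (λ j 1≤j j≤0 → ⊥-elim (<⇒≱ 1≤j j≤0)) , (λ j 0<j j≤0 → ⊥-elim (<⇒≱ 0<j j≤0))
threshold-split {suc s} f inc T with threshold-split {s} f (λ i 1≤i i<s → inc i 1≤i (m≤n⇒m≤1+n i<s)) T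
... | τ , τ≤s , below , above with m≤n⇒m<n∨m≡n τ≤s
...   | inj₁ τ<s = τ , m≤n⇒m≤1+n τ≤s , below , above′
  where
  above′ : ∀ j → τ < j → j ≤ suc s → T < f j
  above′ j τ<j j≤1+s with m≤n⇒m<n∨m≡n j≤1+s
  ... | inj₁ j≤s = above j τ<j (≤-pred j≤s)
  ... | inj₂ refl = <-trans (above s τ<s ≤-refl) (inc s (≤-trans (s≤s z≤n) τ<s) ≤-refl)
threshold-split {suc s} f inc T | τ , τ≤s , below , above | inj₂ refl with f (suc τ) ≤? T
...   | yes f≤T = suc τ , ≤-refl , below′ , (λ j τ<j j≤τ → ⊥-elim (<⇒≱ τ<j j≤τ))
  where
  below′ : ∀ j → 1 ≤ j → j ≤ suc τ → f j ≤ T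
  below′ j 1≤j j≤1+τ with m≤n⇒m<n∨m≡n j≤1+τ
  ... | inj₁ j≤τ = below j 1≤j (≤-pred j≤τ)
  ... | inj₂ refl = f≤T
...   | no f≰T = τ , n≤1+n τ , below , above′
  where
  above′ : ∀ j → τ < j → j ≤ suc τ → T < f j
  above′ j τ<j j≤1+τ rewrite ≤-antisym j≤1+τ τ<j = ≰⇒> f≰T

rotate-+ : ∀ f n s t j d → rotate f n s t (j + d) ≡ rotate f n s (d + t) j
rotate-+ f n s t j d = cong (λ k → if k ≤ᵇ s then f k else f (k ∸ s) + n) (+-assoc j d t)

-- On a window where f lies in (K, K + n] up to τ and in (K + n, K + 2n] after, rotating by τ sorts the residues.
rotate-residue : ∀ f n s τ K → τ ≤ s →
  (∀ j → 1 ≤ j → j ≤ τ → md (f j) n + K ≡ f j) → (∀ j → τ < j → j ≤ s → md (f j) n + (K + n) ≡ f j) →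
  ∀ i → 1 ≤ i → i ≤ s → rotate f n s τ i ≡ md (f (md (i + τ) s)) n + (K + n)
rotate-residue f n s τ K τ≤s low high i 1≤i i≤s with i + τ ≤? s
... | yes i+τ≤s rewrite rotate-≤ f n s τ i i+τ≤s | md-id s (i + τ) (≤-trans 1≤i (m≤m+n i τ)) i+τ≤s =
  sym (high (i + τ) (m<n+m τ 1≤i) i+τ≤s)
... | no i+τ≰s rewrite rotate-> f n s τ i (≰⇒> i+τ≰s) | md-wrap s (i + τ) (≰⇒> i+τ≰s) (+-mono-≤ i≤s τ≤s) =
  trans (cong (_+ n) (sym (low j (m<n⇒0<n∸m (≰⇒> i+τ≰s)) (m≤n+o⇒m∸n≤o (i + τ) s (+-monoˡ-≤ τ i≤s)))))
        (+-assoc (md (f j) n) K n)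
  where
  j : ℕ
  j = i + τ ∸ s

module Normalized {n s : ℕ} {α β : ℕ → ℕ} (1≤n : 1 ≤ n) (1≤s : 1 ≤ s)
                  (I : Interlaced n s α β) (n<β₁ : n < β 1) (β₁≤2n : β 1 ≤ n + n) where
  open Interlaced I

  αₛ<α₁+n : α s < α 1 + n
  αₛ<α₁+n = ≤-<-trans αₛ≤β₁ (β<α+n 1 ≤-refl 1≤s)

  βₛ<β₁+n : β s < β 1 + n
  βₛ<β₁+n = <-≤-trans (β<α+n s 1≤s ≤-refl) (+-monoˡ-≤ n αₛ≤β₁)

  α-mono : ∀ {i j} → 1 ≤ i → i ≤ j → j ≤ s → α i ≤ α j
  α-mono = increasing-mono-≤ α α-increasing

  β-mono : ∀ {i j} → 1 ≤ i → i ≤ j → j ≤ s → β i ≤ β j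
  β-mono = increasing-mono-≤ β β-increasing

  1≤α : ∀ {j} → 1 ≤ j → j ≤ s → 1 ≤ α j
  1≤α 1≤j j≤s = ≤-trans (+-cancelʳ-< n 0 (α 1) (<-trans n<β₁ (β<α+n 1 ≤-refl 1≤s))) (α-mono ≤-refl 1≤j j≤s)

  α≤2n : ∀ {j} → 1 ≤ j → j ≤ s → α j ≤ n + n
  α≤2n 1≤j j≤s = ≤-trans (α-mono 1≤j j≤s ≤-refl) (≤-trans αₛ≤β₁ β₁≤2n)

  n<β : ∀ {j} → 1 ≤ j → j ≤ s → n < β j
  n<β 1≤j j≤s = <-≤-trans n<β₁ (β-mono ≤-refl 1≤j j≤s)

  β≤3n : ∀ {j} → 1 ≤ j → j ≤ s → β j ≤ n + n + n
  β≤3n 1≤j j≤s = ≤-trans (<⇒≤ (β<α+n _ 1≤j j≤s)) (+-monoˡ-≤ n (α≤2n 1≤j j≤s))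

  αSplit = threshold-split α α-increasing n
  βSplit = threshold-split β β-increasing (n + n)

  τ τ′ : ℕ
  τ  = proj₁ αSplit
  τ′ = proj₁ βSplit

  τ≤s : τ ≤ s
  τ≤s = proj₁ (proj₂ αSplit)

  τ′≤s : τ′ ≤ s
  τ′≤s = proj₁ (proj₂ βSplit)

  α-low : ∀ j → 1 ≤ j → j ≤ τ → md (α j) n + 0 ≡ α j
  α-low j 1≤j j≤τ = trans (+-identityʳ _)
    (md-id n (α j) (1≤α 1≤j (≤-trans j≤τ τ≤s)) (proj₁ (proj₂ (proj₂ αSplit)) j 1≤j j≤τ))

  α-high : ∀ j → τ < j → j ≤ s → md (α j) n + (0 + n) ≡ α j
  α-high j τ<j j≤s = md-lift₁ (α j) n (proj₂ (proj₂ (proj₂ αSplit)) j τ<j j≤s) (α≤2n (<-≤-trans (s≤s z≤n) τ<j) j≤s)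

  β-low : ∀ j → 1 ≤ j → j ≤ τ′ → md (β j) n + n ≡ β j
  β-low j 1≤j j≤τ′ = md-lift₁ (β j) n (n<β 1≤j (≤-trans j≤τ′ τ′≤s)) (proj₁ (proj₂ (proj₂ βSplit)) j 1≤j j≤τ′)

  β-high : ∀ j → τ′ < j → j ≤ s → md (β j) n + (n + n) ≡ β j
  β-high j τ′<j j≤s = md-lift₂ (β j) n (proj₂ (proj₂ (proj₂ βSplit)) j τ′<j j≤s) (β≤3n (<-≤-trans (s≤s z≤n) τ′<j) j≤s)

  τ≤τ′ : τ ≤ τ′
  τ≤τ′ with τ ≤? τ′
  ... | yes τ≤τ′ = τ≤τ′
  ... | no τ≰τ′ = ⊥-elim (<⇒≱ (proj₂ (proj₂ (proj₂ βSplit)) τ (≰⇒> τ≰τ′) τ≤s)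
                    (<⇒≤ (<-≤-trans (β<α+n τ 1≤τ τ≤s) (+-monoˡ-≤ n (proj₁ (proj₂ (proj₂ αSplit)) τ 1≤τ ≤-refl)))))
    where
    1≤τ : 1 ≤ τ
    1≤τ = <-≤-trans (s≤s z≤n) (≰⇒> τ≰τ′)

  A B : ℕ → ℕ
  A i = md (α (md (i + τ) s)) n
  B i = md (β (md (i + τ′) s)) n

  A-rotate : ∀ i → 1 ≤ i → i ≤ s → rotate α n s τ i ≡ A i + n
  A-rotate = rotate-residue α n s τ 0 τ≤s α-low α-high

  B-rotate : ∀ i → 1 ≤ i → i ≤ s → rotate β n s τ′ i ≡ B i + (n + n)
  B-rotate = rotate-residue β n s τ′ n τ′≤s β-low β-high

  A-sorted : SortedSubset n s A
  A-sorted = (λ i _ _ → md-bounds _ n 1≤n) , λ i 1≤i i<s →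
    +-cancelʳ-< n _ _ (subst₂ _<_ (A-rotate i 1≤i (<⇒≤ i<s)) (A-rotate (suc i) (s≤s z≤n) i<s)
      (rotate-increasing α n s τ τ≤s α-increasing αₛ<α₁+n i 1≤i i<s))

  B-sorted : SortedSubset n s B
  B-sorted = (λ i _ _ → md-bounds _ n 1≤n) , λ i 1≤i i<s →
    +-cancelʳ-< (n + n) _ _ (subst₂ _<_ (B-rotate i 1≤i (<⇒≤ i<s)) (B-rotate (suc i) (s≤s z≤n) i<s)
      (rotate-increasing β n s τ′ τ′≤s β-increasing βₛ<β₁+n i 1≤i i<s))

  ℓ′ : ℕ
  ℓ′ = τ′ ∸ τ

  ℓ′+τ≡τ′ : ℓ′ + τ ≡ τ′
  ℓ′+τ≡τ′ = m∸n+n≡m τ≤τ′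

  A-shift : ∀ i → 1 ≤ i → i + ℓ′ ≤ s → A (i + ℓ′) + n ≡ rotate α n s τ′ i
  A-shift i 1≤i i+ℓ′≤s = begin
    A (i + ℓ′) + n          ≡⟨ sym (A-rotate (i + ℓ′) (≤-trans 1≤i (m≤m+n i ℓ′)) i+ℓ′≤s) ⟩
    rotate α n s τ (i + ℓ′) ≡⟨ rotate-+ α n s τ i ℓ′ ⟩
    rotate α n s (ℓ′ + τ) i ≡⟨ cong (λ t → rotate α n s t i) ℓ′+τ≡τ′ ⟩
    rotate α n s τ′ i       ∎
    where open ≡-Reasoning

  shift-good : Good A B s ℓ′
  shift-good i 1≤i i+ℓ′≤s = +-cancelʳ-< (n + n) (B i) (A (i + ℓ′))
    (subst₂ _<_ (B-rotate i 1≤i i≤s) (trans (cong (_+ n) (sym (A-shift i 1≤i i+ℓ′≤s))) (+-assoc _ n n))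
      (rotate-pointwise α β n s τ′ β<α+n τ′≤s i 1≤i i≤s))
    where
    i≤s : i ≤ s
    i≤s = ≤-trans (m≤m+n i ℓ′) i+ℓ′≤s

  -- The witness: at shift ℓ′ − 1 the last α faces the first β, and αₛ ≤ β₁.
  shift-tight : ∀ p → ℓ′ ≡ suc p → Violated A B s p
  shift-tight p ℓ′≡1+p with m≤n⇒∃[o]m+o≡n τ′≤s
  ... | r , τ′+r≡s = suc r , s≤s z≤n , ≤-trans (m≤m+n (suc r + p) τ) (≤-reflexive i+p+τ≡s) , A≤B
    where
    i+p+τ≡s : suc r + p + τ ≡ s
    i+p+τ≡s = begin
      suc r + p + τ ≡⟨ rearrange r p τ ⟩
      r + (suc p + τ) ≡⟨ cong (λ l → r + (l + τ)) (sym ℓ′≡1+p) ⟩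
      r + (ℓ′ + τ)  ≡⟨ cong (r +_) ℓ′+τ≡τ′ ⟩
      r + τ′        ≡⟨ +-comm r τ′ ⟩
      τ′ + r        ≡⟨ τ′+r≡s ⟩
      s             ∎
      where
      open ≡-Reasoning
      rearrange : ∀ r p τ → suc r + p + τ ≡ r + (suc p + τ)
      rearrange = solve-∀
    1≤τ′ : 1 ≤ τ′
    1≤τ′ = subst (1 ≤_) ℓ′+τ≡τ′ (subst (λ l → 1 ≤ l + τ) (sym ℓ′≡1+p) (s≤s z≤n))
    A≡αₛ : A (suc r + p) + n ≡ α s
    A≡αₛ = trans (sym (A-rotate (suc r + p) (s≤s z≤n) (≤-trans (m≤m+n (suc r + p) τ) (≤-reflexive i+p+τ≡s))))
             (trans (rotate-≤ α n s τ (suc r + p) (≤-reflexive i+p+τ≡s)) (cong α i+p+τ≡s))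
    r+τ′≡s : r + τ′ ≡ s
    r+τ′≡s = trans (+-comm r τ′) τ′+r≡s
    B≡β₁ : B (suc r) + (n + n) ≡ β 1 + n
    B≡β₁ = begin
      B (suc r) + (n + n)     ≡⟨ sym (B-rotate (suc r) (s≤s z≤n) (subst (suc r ≤_) τ′+r≡s (+-monoˡ-≤ r 1≤τ′))) ⟩
      rotate β n s τ′ (suc r) ≡⟨ rotate-> β n s τ′ (suc r) (s≤s (≤-reflexive (sym r+τ′≡s))) ⟩
      β (suc r + τ′ ∸ s) + n  ≡⟨ cong (λ k → β (suc k ∸ s) + n) r+τ′≡s ⟩
      β (suc s ∸ s) + n       ≡⟨ cong (λ k → β k + n) (m+n∸n≡m 1 s) ⟩
      β 1 + n                 ∎
      where open ≡-Reasoning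
    A≤B : A (suc r + p) ≤ B (suc r)
    A≤B = +-cancelʳ-≤ n _ _ (+-cancelʳ-≤ n _ _ (≤-trans (+-monoˡ-≤ n (subst (_≤ β 1) (sym A≡αₛ) αₛ≤β₁))
            (≤-reflexive (trans (sym B≡β₁) (sym (+-assoc (B (suc r)) n n))))))

  ℓ′≤s : ℓ′ ≤ s
  ℓ′≤s = ≤-trans (m≤m+n ℓ′ τ) (≤-trans (≤-reflexive ℓ′+τ≡τ′) τ′≤s)

  leastℓ≡ℓ′ : leastℓ A B s ≡ ℓ′
  leastℓ≡ℓ′ = leastℓ-unique A B s ℓ′ (proj₂ A-sorted) ℓ′≤s shift-good shift-tight

  sortedResidues : SortedResidues n s α β
  sortedResidues = record { A = A ; B = B ; A-sorted = A-sorted ; B-sorted = B-sorted ; matching = matching }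
    where
    matching : ∀ i → 1 ≤ i → i ≤ s →
      ∃[ j ] (1 ≤ j × j ≤ s × A (md (i + leastℓ A B s) s) ≡ md (α j) n × B i ≡ md (β j) n)
    matching i 1≤i i≤s rewrite leastℓ≡ℓ′ =
      md (i + τ′) s , proj₁ (md-bounds (i + τ′) s 1≤s) , proj₂ (md-bounds (i + τ′) s 1≤s) , cong (λ k → md (α k) n) index≡ , refl
      where
      index≡ : md (md (i + ℓ′) s + τ) s ≡ md (i + τ′) s
      index≡ = begin
        md (md (i + ℓ′) s + τ) s ≡⟨ md-md-+ (i + ℓ′) τ s 1≤s ⟩
        md (i + ℓ′ + τ) s        ≡⟨ cong (λ k → md k s) (+-assoc i ℓ′ τ) ⟩
        md (i + (ℓ′ + τ)) s      ≡⟨ cong (λ k → md (i + k) s) ℓ′+τ≡τ′ ⟩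
        md (i + τ′) s            ∎
        where open ≡-Reasoning

interlaced-+n : ∀ {n s α β} → Interlaced n s α β → β 1 ≤ n → Interlaced n s (λ j → α j + n) (λ j → β j + n)
interlaced-+n {n} I β₁≤n = record
  { α-increasing = λ i 1≤i i<s → +-monoˡ-< n (α-increasing i 1≤i i<s)
  ; β-increasing = λ i 1≤i i<s → +-monoˡ-< n (β-increasing i 1≤i i<s)
  ; αₛ≤β₁ = +-monoˡ-≤ n αₛ≤β₁
  ; β<α+n = λ j 1≤j j≤s → +-monoˡ-< n (β<α+n j 1≤j j≤s)
  ; 1≤β₁ = ≤-trans 1≤β₁ (m≤m+n _ n)
  ; β₁≤3n = ≤-trans (+-monoˡ-≤ n β₁≤n) (m≤m+n (n + n) n) }
  where open Interlaced I

interlaced-above : ∀ {n s α β} → 1 ≤ s → Interlaced n s α β → n + n < β 1 →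
  ∀ {j} → 1 ≤ j → j ≤ s → n < α j × n ≤ β j
interlaced-above {n} {s} {α} {β} 1≤s I 2n<β₁ 1≤j j≤s =
    <-≤-trans (+-cancelʳ-< n n (α 1) (<-trans 2n<β₁ (β<α+n 1 ≤-refl 1≤s))) (increasing-mono-≤ α α-increasing ≤-refl 1≤j j≤s)
  , ≤-trans (m≤m+n n n) (<⇒≤ (<-≤-trans 2n<β₁ (increasing-mono-≤ β β-increasing ≤-refl 1≤j j≤s)))
  where open Interlaced I

interlaced-∸n : ∀ {n s α β} → 1 ≤ s → Interlaced n s α β → n + n < β 1 →
  Interlaced n s (λ j → α j ∸ n) (λ j → β j ∸ n)
interlaced-∸n {n} {s} {α} {β} 1≤s I 2n<β₁ = record
  { α-increasing = λ i 1≤i i<s → ∸-monoˡ-< (α-increasing i 1≤i i<s) (<⇒≤ (n<α 1≤i (<⇒≤ i<s)))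
  ; β-increasing = λ i 1≤i i<s → ∸-monoˡ-< (β-increasing i 1≤i i<s) (n≤β 1≤i (<⇒≤ i<s))
  ; αₛ≤β₁ = ∸-monoˡ-≤ n αₛ≤β₁
  ; β<α+n = λ j 1≤j j≤s → +-cancelʳ-< n _ _ (subst₂ _<_ (sym (m∸n+n≡m (n≤β 1≤j j≤s)))
              (cong (_+ n) (sym (m∸n+n≡m (<⇒≤ (n<α 1≤j j≤s))))) (β<α+n j 1≤j j≤s))
  ; 1≤β₁ = ≤-trans (s≤s z≤n) (m+n≤o⇒m≤o∸n (suc n) 2n<β₁)
  ; β₁≤3n = ≤-trans (subst (β 1 ∸ n ≤_) (m+n∸n≡m (n + n) n) (∸-monoˡ-≤ n β₁≤3n)) (m≤m+n (n + n) n) }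
  where
  open Interlaced I
  n<α : ∀ {j} → 1 ≤ j → j ≤ s → n < α j
  n<α 1≤j j≤s = proj₁ (interlaced-above 1≤s I 2n<β₁ 1≤j j≤s)
  n≤β : ∀ {j} → 1 ≤ j → j ≤ s → n ≤ β j
  n≤β 1≤j j≤s = proj₂ (interlaced-above 1≤s I 2n<β₁ 1≤j j≤s)

sortedResidues : ∀ {n s α β} → 1 ≤ n → 1 ≤ s → Interlaced n s α β → SortedResidues n s α β
sortedResidues {n} {s} {α} {β} 1≤n 1≤s I with β 1 ≤? n | β 1 ≤? n + n
... | yes β₁≤n | _ = sortedResidues-cong (λ j _ _ → md-periodic n (α j) , md-periodic n (β j))
  (Normalized.sortedResidues 1≤n 1≤s (interlaced-+n I β₁≤n) (+-monoˡ-≤ n (Interlaced.1≤β₁ I)) (+-monoˡ-≤ n β₁≤n))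
... | no β₁≰n | yes β₁≤2n = Normalized.sortedResidues 1≤n 1≤s I (≰⇒> β₁≰n) β₁≤2n
... | no _ | no β₁≰2n = sortedResidues-cong shifted-residues
  (Normalized.sortedResidues 1≤n 1≤s (interlaced-∸n 1≤s I (≰⇒> β₁≰2n)) (m+n≤o⇒m≤o∸n (suc n) (≰⇒> β₁≰2n))
    (subst (β 1 ∸ n ≤_) (m+n∸n≡m (n + n) n) (∸-monoˡ-≤ n (Interlaced.β₁≤3n I))))
  where
  shifted-residues : ∀ j → 1 ≤ j → j ≤ s → md (α j ∸ n) n ≡ md (α j) n × md (β j ∸ n) n ≡ md (β j) n
  shifted-residues j 1≤j j≤s with interlaced-above 1≤s I (≰⇒> β₁≰2n) 1≤j j≤s
  ... | n<α , n≤β = md-∸ n (α j) (<⇒≤ n<α) , md-∸ n (β j) n≤β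

nth : List ℕ → ℕ → ℕ
nth []       _       = 0
nth (x ∷ xs) zero    = x
nth (x ∷ xs) (suc j) = nth xs j

nth∈ : ∀ xs j → j < length xs → nth xs j ∈ xs
nth∈ (x ∷ xs) zero    _         = here refl
nth∈ (x ∷ xs) (suc j) (s≤s j<n) = there (nth∈ xs j j<n)

nth-strict : ∀ xs → Linked _≤_ xs → Unique xs → ∀ j → suc j < length xs → nth xs j < nth xs (suc j)
nth-strict (x ∷ [])     _ _      j       (s≤s ())
nth-strict (x ∷ y ∷ xs) ↗ unique zero    _         = ≤∧≢⇒< (Linked.head ↗) (All.head (AllPairs.head unique))
nth-strict (x ∷ y ∷ xs) ↗ unique (suc j) (s≤s j<n) = nth-strict (y ∷ xs) (Linked.tail ↗) (AllPairs.tail unique) j j<n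

Cross⇒start≢ : ∀ {a b c d} → Cross (a , b) (c , d) → a ≢ c
Cross⇒start≢ (inj₁ (a<c , _)) a≡c = <-irrefl a≡c a<c
Cross⇒start≢ (inj₂ (c<a , _)) a≡c = <-irrefl (sym a≡c) c<a

Cross-interleave : ∀ {a b c d} → Cross (a , b) (c , d) → a < c → c < b × b < d
Cross-interleave (inj₁ (_ , c<b , b<d)) _   = c<b , b<d
Cross-interleave (inj₂ (c<a , _))       a<c = ⊥-elim (<-asym c<a a<c)

record SortedEnumeration (n s : ℕ) (σ : Fin s → Segment) : Set where
  field
    x y       : ℕ → ℕ
    sorted    : SortedCrossing n s x y
    enumerates : ∀ j → 1 ≤ j → j ≤ s → ∃[ r ] σ r ≡ (x j , y j)

module _ {n s : ℕ} (σ : Fin s → Segment) (segments : ∀ r → IsSegment n (σ r))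
         (crossing : ∀ r t → r ≢ t → Cross (σ r) (σ t)) (2≤s : 2 ≤ s) where

  private
    start : Fin s → ℕ
    start r = proj₁ (σ r)

    start-injective : ∀ {r t} → start r ≡ start t → r ≡ t
    start-injective {r} {t} eq with r Data.Fin.≟ t
    ... | yes r≡t = r≡t
    ... | no r≢t = ⊥-elim (Cross⇒start≢ (crossing r t r≢t) eq)

    S : List ℕ
    S = sort (tabulate start)

    S-unique : Unique S
    S-unique = Unique-resp-↭ (↭⇒↭ₛ (↭-sym (sort-↭ (tabulate start)))) (tabulate⁺ start-injective)

    length-S : length S ≡ s
    length-S = trans (↭-length (sort-↭ (tabulate start))) (length-tabulate start)

    x : ℕ → ℕ
    x j = nth S (pred j)

    x-start : ∀ {j} → 1 ≤ j → j ≤ s → ∃[ r ] x j ≡ start r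
    x-start {suc j} _ j<s = ∈-tabulate⁻ (∈-resp-↭ (sort-↭ (tabulate start)) (nth∈ S j (subst (j <_) (sym length-S) j<s)))

    endFrom : ∀ {v} → Dec (∃[ r ] start r ≡ v) → ℕ
    endFrom (yes (r , _)) = proj₂ (σ r)
    endFrom (no _)        = 0

    owner : ∀ v → Dec (∃[ r ] start r ≡ v)
    owner v = any? (λ r → start r ≟ v)

    y : ℕ → ℕ
    y j = endFrom (owner (x j))

    enumerates : ∀ j → 1 ≤ j → j ≤ s → ∃[ r ] σ r ≡ (x j , y j)
    enumerates j 1≤j j≤s with owner (x j)
    ... | yes (r , start≡x) = r , cong (_, proj₂ (σ r)) start≡x
    ... | no none = ⊥-elim (none (proj₁ (x-start 1≤j j≤s) , sym (proj₂ (x-start 1≤j j≤s))))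

    x-increasing : Increasing s x
    x-increasing (suc j) _ j+1<s = nth-strict S (sort-↗ (tabulate start)) S-unique j (subst (suc j <_) (sym length-S) j+1<s)

    -- Segments with different starting points are different, so they cross.
    ordered-cross : ∀ {i j} → 1 ≤ i → i < j → j ≤ s → x j < y i × y i < y j
    ordered-cross {i} {j} 1≤i i<j j≤s
      with enumerates i 1≤i (<⇒≤ (<-≤-trans i<j j≤s)) | enumerates j (≤-trans 1≤i (<⇒≤ i<j)) j≤s
    ... | r , σr≡ | t , σt≡ = Cross-interleave (subst₂ Cross σr≡ σt≡ (crossing r t r≢t)) xi<xj
      where
      xi<xj : x i < x j
      xi<xj = increasing-mono-< x x-increasing 1≤i i<j j≤s
      r≢t : r ≢ t
      r≢t r≡t = <-irrefl (cong proj₁ (trans (sym σr≡) (trans (cong σ r≡t) σt≡))) xi<xj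

    1≤s : 1 ≤ s
    1≤s = ≤-trans (s≤s z≤n) 2≤s

  -- Opaque, or type checking tries to evaluate the sort symbolically.
  opaque
    sortedEnumeration : SortedEnumeration n s σ
    sortedEnumeration = record
      { x = x ; y = y ; enumerates = enumerates
      ; sorted = record
        { x-increasing = x-increasing
        ; y-increasing = λ i 1≤i i<s → proj₂ (ordered-cross 1≤i ≤-refl i<s)
        ; xₛ<y₁ = proj₁ (ordered-cross ≤-refl 2≤s ≤-refl)
        ; 1≤x₁ = subst (λ σ₁ → 1 ≤ proj₁ σ₁) (proj₂ first) (proj₁ (segments (proj₁ first)))
        ; yₛ≤2n = subst (λ σₛ → proj₂ σₛ ≤ n + n) (proj₂ last) (proj₂ (proj₂ (segments (proj₁ last)))) } }
      where
      first : ∃[ r ] σ r ≡ (x 1 , y 1)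
      first = enumerates 1 ≤-refl 1≤s
      last : ∃[ r ] σ r ≡ (x s , y s)
      last = enumerates s 1≤s ≤-refl

module _ {n k : ℕ} {e : Monomial} where

  residues⇒generator : ∀ {α β} → SortedResidues n (suc k) α β →
    (∀ j → 1 ≤ j → j ≤ suc k → 1 ≤ e (md (α j) n) (md (β j) n)) → InGen n k e
  residues⇒generator R divides = A , B , A-sorted , B-sorted , λ { p q (i , 1≤i , i≤s , refl , refl) → inN i 1≤i i≤s }
    where
    open SortedResidues R
    inN : ∀ i → 1 ≤ i → i ≤ suc k → 1 ≤ e (A (md (i + leastℓ A B (suc k)) (suc k))) (B i)
    inN i 1≤i i≤s with matching i 1≤i i≤s
    ... | j , 1≤j , j≤s , A≡ , B≡ rewrite A≡ | B≡ = divides j 1≤j j≤s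

  enumeration⇒generator : ∀ {σ} → 1 ≤ n → (∀ r → 1 ≤ e (proj₁ (Ψ n (σ r))) (proj₂ (Ψ n (σ r)))) →
    SortedEnumeration n (suc k) σ → InGen n k e
  enumeration⇒generator {σ} 1≤n inSupport E with interlacedLift 1≤n (s≤s z≤n) (SortedEnumeration.sorted E)
  ... | α , β , interlaced , realizes = residues⇒generator (sortedResidues 1≤n (s≤s z≤n) interlaced) divides
    where
    open SortedEnumeration E
    divides : ∀ j → 1 ≤ j → j ≤ suc k → 1 ≤ e (md (α j) n) (md (β j) n)
    divides j 1≤j j≤s with realizes j 1≤j j≤s
    ... | r , 1≤r , r≤s , Ψ≡ with enumerates r 1≤r r≤s
    ... | ρ , σρ≡ = subst (λ v → 1 ≤ e (proj₁ v) (proj₂ v)) (trans (cong (Ψ n) σρ≡) Ψ≡) (inSupport ρ)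

  crossing⇒generator : 1 ≤ n → 1 ≤ k → SupportHasCrossing n k e → InGen n k e
  crossing⇒generator 1≤n 1≤k (σ , inSupport , crossing) = enumeration⇒generator 1≤n (proj₂ ∘ inSupport)
    (sortedEnumeration σ (proj₁ ∘ proj₁ ∘ inSupport) crossing (s≤s 1≤k))

theorem3p7 : ∀ (n k : ℕ) → 2 ≤ n → 1 ≤ k → k ≤ n ∸ 1 →
    (∀ (a b : ℕ → ℕ) → SortedSubset n (suc k) a → SortedSubset n (suc k) b →
       ∀ p q → InN a b (suc k) p q → InRing n k p q)
    × (∀ (e : Monomial) → IsRingMonomial n k e → (InSR n k e ⇔ InGen n k e))
theorem3p7 n k 2≤n 1≤k _ =
    (λ a b A B → generator-variables A B 1≤n)
  , λ e _ → mk⇔ (crossing⇒generator 1≤n 1≤k) λ (a , b , A , B , divides) → generator⇒crossing A B 1≤n e divides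
  where
  1≤n : 1 ≤ n
  1≤n = ≤-trans (s≤s z≤n) 2≤n
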